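{- Let $(W,N,I)$ be a finite neighbourhood model. Then for every $\psi\in\mathsf{cl}$ there is a timeout $\overline m$ such that $[\![\psi]\!]\subseteq[\![\psi]\!]_{\overline m}$.
   Context: Formulae: $\psi::=\bot\mid\top\mid p\mid\psi\wedge\psi\mid\psi\vee\psi\mid\langle a\rangle\psi\mid[a]\psi\mid X\mid\mu X.\psi\mid\nu X.\psi$ over atoms $p$ (with involution $p\mapsto\overline p$), programs $a$, variables $X$. Neighbourhood model $(W,N,I)$: $N:\mathsf A\times W\to\mathcal P(\mathcal P(W))$, $I$ with $I(\overline p)=W\setminus I(p)$; $[\![\langle a\rangle\psi]\!]=\{w\mid\exists S\in N(a,w).\,S\subseteq[\![\psi]\!]\}$, $[\![[a]\psi]\!]=\{w\mid\forall S\in N(a,w).\,S\cap[\![\psi]\!]\ne\emptyset\}$, Booleans standard, $\mu,\nu$ least/greatest fixpoints. The closure $\mathrm{cl}(\psi)$ is the least set containing $\psi$, closed under immediate subformulae of $\wedge,\vee,\langle a\rangle,[a]$ and containing $\psi_1[\eta X.\psi_1/X]$ whenever it contains $\eta X.\psi_1$. Fix closed formulae $\rho_1,\rho_0$ that are clean (each variable bound once; $\theta(X)$ denotes the subformula $\eta X.\phi$ binding $X$), irredundant ($X$ free in $\phi$ whenever $\eta X.\phi$ is in the closure), guarded (in every $\eta X.\phi$ in the closure, free occurrences of $X$ are under a modal operator) and alternation-free (no subformula has both a free $\mu$-bound and a free $\nu$-bound variable); put $\mathsf{cl}=\mathrm{cl}(\rho_1)\cup\mathrm{cl}(\rho_0)$.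 For $\mu$-bound variables $X,Y$ of $\rho_1,\rho_0$, let $X\ge_\mu Y$ iff $\theta(Y)$ is a subformula of $\theta(X)$ not in the scope of a $\nu$-operator within $\theta(X)$; $\mathrm{idx}(X)=|\{Y\mid Y\ge_\mu X\}|$. For a subformula $\chi$, $\mathrm{clf}(\chi)$ is the closed formula obtained by repeatedly substituting $\theta(X)$ for the free variable $X$ whose binder is innermost, until no free variables remain. A formula $\phi\in\mathsf{cl}$ is a deferral ($\phi\in\mathsf{dfr}$) if $\phi=\mathrm{clf}(\chi)$ for a subformula $\chi$ of $\rho_1$ or $\rho_0$ having a free $\mu$-bound variable. Let $k$ be the greatest index of a $\mu$-bound variable. A timeout is a vector $\overline m=(m_1,\dots,m_k)$ of naturals $m_i\le|W|$; for $m_i>0$, $\overline m@i=(m_1,\dots,m_{i-1},m_i-1,|W|,\dots,|W|)$. The extension under timeout is defined by $[\![\phi]\!]_{\overline m}=[\![\phi]\!]$ for $\phi\notin\mathsf{dfr}$, and for $\phi\in\mathsf{dfr}$ by: $\wedge,\vee$ as intersection/union of the timed extensions of the components; $[\![\langle a\rangle\psi]\!]_{\overline m}=\{w\mid\exists S\in N(a,w).\,S\subseteq[\![\psi]\!]_{\overline m}\}$; $[\![[a]\psi]\!]_{\overline m}=\{w\mid\forall S\in N(a,w).\,S\cap[\![\psi]\!]_{\overline m}\ne\emptyset\}$; $[\![\mu X.\psi]\!]_{\overline m}=\emptyset$ if $m_{\mathrm{idx}(X)}=0$ and $=[\![\psi[\mu X.\psi/X]]\!]_{\overline m@\mathrm{idx}(X)}$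 otherwise (well-defined by lexicographic induction on $(\overline m,\phi)$). -}

module Defs where

open import Data.Nat using (ℕ; zero; suc; _∸_; _⊔_; _≤_)
open import Data.Nat using (_≡ᵇ_)
open import Data.Bool using (Bool; true; false; not; _∧_; _∨_; if_then_else_)
open import Data.Fin using (Fin)
open import Data.List using (List; []; _∷_; _++_; foldr; map; concatMap)
import Data.List as L
open import Data.Bool.ListAction using (all; any)
open import Data.Vec using (Vec; []; _∷_; lookup; tabulate; replicate; zipWith)
import Data.Vec as V
open import Data.Maybe using (Maybe; just; nothing; _<∣>_)
open import Data.Product using (Σ; ∃; _×_; _,_)
open import Data.Sum using (_⊎_)
open import Data.Empty using (⊥)
open import Relation.Nullary using (¬_)
open import Relation.Binary.PropositionalEquality using (_≡_; _≢_)
open import Data.List.Relation.Unary.Unique.Propositional using (Unique)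

-- Syntax.  Atoms, programs and variables are natural numbers.
-- lit true p  is the atom p,  lit false p  is its involution p̄.

data Fm : Set where
  ff tt   : Fm
  lit     : Bool → ℕ → Fm
  and or  : Fm → Fm → Fm
  dia box : ℕ → Fm → Fm
  var     : ℕ → Fm
  mu nu   : ℕ → Fm → Fm

_==_ : Fm → Fm → Bool
ff == ff = true
tt == tt = true
lit b p == lit c q = ((b ∧ c) ∨ (not b ∧ not c)) ∧ (p ≡ᵇ q)
and a b == and c d = (a == c) ∧ (b == d)
or a b == or c d = (a == c) ∧ (b == d)
dia x a == dia y b = (x ≡ᵇ y) ∧ (a == b)
box x a == box y b = (x ≡ᵇ y) ∧ (a == b)
var x == var y = x ≡ᵇ y
mu x a == mu y b = (x ≡ᵇ y) ∧ (a == b)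
nu x a == nu y b = (x ≡ᵇ y) ∧ (a == b)
_ == _ = false

sub : Fm → Fm → ℕ → Fm
sub ff t X = ff
sub tt t X = tt
sub (lit b p) t X = lit b p
sub (and a b) t X = and (sub a t X) (sub b t X)
sub (or a b) t X = or (sub a t X) (sub b t X)
sub (dia x a) t X = dia x (sub a t X)
sub (box x a) t X = box x (sub a t X)
sub (var Y) t X = if Y ≡ᵇ X then t else var Y
sub (mu Y a) t X = if Y ≡ᵇ X then mu Y a else mu Y (sub a t X)
sub (nu Y a) t X = if Y ≡ᵇ X then nu Y a else nu Y (sub a t X)

data FreeIn (X : ℕ) : Fm → Set where
  fvar : FreeIn X (var X)
  fandl : ∀ {a b} → FreeIn X a → FreeIn X (and a b)
  fandr : ∀ {a b} → FreeIn X b → FreeIn X (and a b)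
  forl : ∀ {a b} → FreeIn X a → FreeIn X (or a b)
  forr : ∀ {a b} → FreeIn X b → FreeIn X (or a b)
  fdia : ∀ {x a} → FreeIn X a → FreeIn X (dia x a)
  fbox : ∀ {x a} → FreeIn X a → FreeIn X (box x a)
  fmu : ∀ {Y a} → Y ≢ X → FreeIn X a → FreeIn X (mu Y a)
  fnu : ∀ {Y a} → Y ≢ X → FreeIn X a → FreeIn X (nu Y a)

Closed : Fm → Set
Closed φ = ∀ X → ¬ FreeIn X φ

data SubF (χ : Fm) : Fm → Set where
  sref : SubF χ χ
  sandl : ∀ {a b} → SubF χ a → SubF χ (and a b)
  sandr : ∀ {a b} → SubF χ b → SubF χ (and a b)
  sorl : ∀ {a b} → SubF χ a → SubF χ (or a b)
  sorr : ∀ {a b} → SubF χ b → SubF χ (or a b)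
  sdia : ∀ {x a} → SubF χ a → SubF χ (dia x a)
  sbox : ∀ {x a} → SubF χ a → SubF χ (box x a)
  smu : ∀ {Y a} → SubF χ a → SubF χ (mu Y a)
  snu : ∀ {Y a} → SubF χ a → SubF χ (nu Y a)

data InCl (ρ : Fm) : Fm → Set where
  croot : InCl ρ ρ
  candl : ∀ {a b} → InCl ρ (and a b) → InCl ρ a
  candr : ∀ {a b} → InCl ρ (and a b) → InCl ρ b
  corl : ∀ {a b} → InCl ρ (or a b) → InCl ρ a
  corr : ∀ {a b} → InCl ρ (or a b) → InCl ρ b
  cdia : ∀ {x a} → InCl ρ (dia x a) → InCl ρ a
  cbox : ∀ {x a} → InCl ρ (box x a) → InCl ρ a
  cmu : ∀ {X a} → InCl ρ (mu X a) → InCl ρ (sub a (mu X a) X)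
  cnu : ∀ {X a} → InCl ρ (nu X a) → InCl ρ (sub a (nu X a) X)

boundVars : Fm → List ℕ
boundVars (and a b) = boundVars a ++ boundVars b
boundVars (or a b) = boundVars a ++ boundVars b
boundVars (dia _ a) = boundVars a
boundVars (box _ a) = boundVars a
boundVars (mu X a) = X ∷ boundVars a
boundVars (nu X a) = X ∷ boundVars a
boundVars _ = []

muVarsOf : Fm → List ℕ
muVarsOf (and a b) = muVarsOf a ++ muVarsOf b
muVarsOf (or a b) = muVarsOf a ++ muVarsOf b
muVarsOf (dia _ a) = muVarsOf a
muVarsOf (box _ a) = muVarsOf a
muVarsOf (mu X a) = X ∷ muVarsOf a
muVarsOf (nu X a) = muVarsOf a
muVarsOf _ = []

findB : ℕ → Fm → Maybe Fm
findB X (and a b) = findB X a <∣> findB X b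
findB X (or a b) = findB X a <∣> findB X b
findB X (dia _ a) = findB X a
findB X (box _ a) = findB X a
findB X (mu Y a) = if Y ≡ᵇ X then just (mu Y a) else findB X a
findB X (nu Y a) = if Y ≡ᵇ X then just (nu Y a) else findB X a
findB X _ = nothing

guardedIn : ℕ → Fm → Bool
guardedIn X (var Y) = not (Y ≡ᵇ X)
guardedIn X (and a b) = guardedIn X a ∧ guardedIn X b
guardedIn X (or a b) = guardedIn X a ∧ guardedIn X b
guardedIn X (mu Y a) = if Y ≡ᵇ X then true else guardedIn X a
guardedIn X (nu Y a) = if Y ≡ᵇ X then true else guardedIn X a
guardedIn X _ = true

occNN : Fm → Fm → Bool
occNN χ φ = (χ == φ) ∨ go φ
  where
  go : Fm → Bool
  go (and a b) = occNN χ a ∨ occNN χ b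
  go (or a b) = occNN χ a ∨ occNN χ b
  go (dia _ a) = occNN χ a
  go (box _ a) = occNN χ a
  go (mu _ a) = occNN χ a
  go _ = false

count : (ℕ → Bool) → List ℕ → ℕ
count p [] = 0
count p (x ∷ xs) = if p x then suc (count p xs) else count p xs

module Syn (ρ1 ρ0 : Fm) where

  -- membership in cl = cl(ρ1) ∪ cl(ρ0)
  InCL : Fm → Set
  InCL φ = InCl ρ1 φ ⊎ InCl ρ0 φ

  SubAny : Fm → Set
  SubAny χ = SubF χ ρ1 ⊎ SubF χ ρ0

  theta : ℕ → Maybe Fm
  theta X = findB X ρ1 <∣> findB X ρ0

  IsMu : ℕ → Set
  IsMu X = ∃ λ φ → theta X ≡ just (mu X φ)

  IsNu : ℕ → Set
  IsNu X = ∃ λ φ → theta X ≡ just (nu X φ)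

  Clean : Set
  Clean = Unique (boundVars ρ1 ++ boundVars ρ0)

  Irredundant : Set
  Irredundant = ∀ X φ → (InCL (mu X φ) → FreeIn X φ) × (InCL (nu X φ) → FreeIn X φ)

  Guarded : Set
  Guarded = ∀ X φ → (InCL (mu X φ) → guardedIn X φ ≡ true)
                  × (InCL (nu X φ) → guardedIn X φ ≡ true)

  AltFree : Set
  AltFree = ∀ χ → SubAny χ → ∀ X Y → FreeIn X χ → FreeIn Y χ → IsMu X → IsNu Y → ⊥

  -- clf: Clf χ φ  means φ = clf(χ): repeatedly substitute θ(X) for the
  -- free variable X of χ whose binder is innermost
  data Clf : Fm → Fm → Set where
    clf-done : ∀ {χ} → Closed χ → Clf χ χ
    clf-step : ∀ {χ φ X b} → FreeIn X χ → theta X ≡ just b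
             → (∀ Y → FreeIn Y χ → Y ≢ X → ∃ λ b' → theta Y ≡ just b' × SubF b b')
             → Clf (sub χ b X) φ → Clf χ φ

  Dfr : Fm → Set
  Dfr φ = InCL φ × ∃ λ χ → SubAny χ × (∃ λ X → FreeIn X χ × IsMu X) × Clf χ φ

  muVars : List ℕ
  muVars = muVarsOf ρ1 ++ muVarsOf ρ0

  geMu : ℕ → ℕ → Bool
  geMu X Y with theta X | theta Y
  ... | just bx | just by = occNN by bx
  ... | _ | _ = false

  idx : ℕ → ℕ
  idx X = count (λ Y → geMu Y X) muVars

  k : ℕ
  k = foldr _⊔_ 0 (map idx muVars)

open Syn public

Subset : ℕ → Set
Subset n = Vec Bool n

allSubsets : (n : ℕ) → List (Subset n)
allSubsets zero = [] ∷ []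
allSubsets (suc n) = concatMap (λ s → (false ∷ s) ∷ (true ∷ s) ∷ []) (allSubsets n)

record Model : Set where
  field
    n : ℕ
    N : ℕ → Fin n → Subset n → Bool
    I : ℕ → Subset n                   -- I(p); I(p̄) is its complement

module Semantics (M : Model) where
  open Model M

  allW : List (Fin n)
  allW = L.allFin n

  _⊆ᵇ_ : Subset n → Subset n → Bool
  S ⊆ᵇ T = all (λ v → not (lookup S v) ∨ lookup T v) allW

  meets : Subset n → Subset n → Bool
  meets S T = any (λ v → lookup S v ∧ lookup T v) allW

  Env : Set
  Env = ℕ → Subset n

  upd : Env → ℕ → Subset n → Env
  upd e X S Y = if Y ≡ᵇ X then S else e Y

  semE : Env → Fm → Subset n
  semE e ff = replicate n false
  semE e tt = replicate n true
  semE e (lit true p) = I p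
  semE e (lit false p) = V.map not (I p)
  semE e (and a b) = zipWith _∧_ (semE e a) (semE e b)
  semE e (or a b) = zipWith _∨_ (semE e a) (semE e b)
  semE e (dia x a) = tabulate λ w → any (λ S → N x w S ∧ (S ⊆ᵇ semE e a)) (allSubsets n)
  semE e (box x a) = tabulate λ w → all (λ S → not (N x w S) ∨ meets S (semE e a)) (allSubsets n)
  semE e (var X) = e X
  -- least fixpoint: intersection of all prefixed points
  semE e (mu X a) = tabulate λ w →
    all (λ S → not (semE (upd e X S) a ⊆ᵇ S) ∨ lookup S w) (allSubsets n)
  -- greatest fixpoint: union of all postfixed points
  semE e (nu X a) = tabulate λ w →
    any (λ S → (S ⊆ᵇ semE (upd e X S) a) ∧ lookup S w) (allSubsets n)

  -- ⟦φ⟧ for closed φ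
  sem : Fm → Subset n
  sem = semE (λ _ → replicate n false)

  -- 1-based component of a timeout
  getT : ∀ {j} → Vec ℕ j → ℕ → ℕ
  getT [] _ = 0
  getT (x ∷ xs) zero = 0
  getT (x ∷ xs) (suc zero) = x
  getT (x ∷ xs) (suc (suc i)) = getT xs (suc i)

  -- m @ i  (1-based i):  (m1,…,m_{i-1}, m_i - 1, |W|, …, |W|)
  atT : ∀ {j} → Vec ℕ j → ℕ → Vec ℕ j
  atT [] _ = []
  atT (x ∷ xs) zero = x ∷ xs
  atT (x ∷ xs) (suc zero) = (x ∸ 1) ∷ replicate _ n
  atT (x ∷ xs) (suc (suc i)) = x ∷ atT xs (suc i)

  module Timed (ρ1 ρ0 : Fm) where
    -- w ∈ ⟦φ⟧_m  (inductively generated by the defining clauses)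
    data TSem : Vec ℕ (k ρ1 ρ0) → Fm → Fin n → Set where
      t-nd  : ∀ {m φ w} → ¬ Dfr ρ1 ρ0 φ → lookup (sem φ) w ≡ true → TSem m φ w
      t-and : ∀ {m a b w} → Dfr ρ1 ρ0 (and a b) → TSem m a w → TSem m b w → TSem m (and a b) w
      t-orl : ∀ {m a b w} → Dfr ρ1 ρ0 (or a b) → TSem m a w → TSem m (or a b) w
      t-orr : ∀ {m a b w} → Dfr ρ1 ρ0 (or a b) → TSem m b w → TSem m (or a b) w
      t-dia : ∀ {m x a w} → Dfr ρ1 ρ0 (dia x a) → (S : Subset n) → N x w S ≡ true
            → (∀ v → lookup S v ≡ true → TSem m a v) → TSem m (dia x a) w
      t-box : ∀ {m x a w} → Dfr ρ1 ρ0 (box x a)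
            → (∀ S → N x w S ≡ true → ∃ λ v → lookup S v ≡ true × TSem m a v)
            → TSem m (box x a) w
      t-mu  : ∀ {m X a w j} → Dfr ρ1 ρ0 (mu X a)
            → getT m (idx ρ1 ρ0 X) ≡ suc j
            → TSem (atT m (idx ρ1 ρ0 X)) (sub a (mu X a) X) w
            → TSem m (mu X a) w

  open Timed public

open Semantics public

module Submission where

-- The timeout (|W|, …, |W|) works for every ψ.  Every closure formula is an
-- instance c[s] of a subformula c of ρ1 or ρ0, where s sends each free variable
-- Z of c to a closed unfolding of θ(Z) that is itself such an instance.  By
-- induction on c, ⟦c⟧ₑ ⊆ ⟦c[s]⟧ₘ for every environment e that
-- under-approximates s.  At a binder μY.c the least fixpoint is reached after
-- |W| Kleene steps, and the j-th approximant lies in the timed extension under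
-- any timeout whose idx(Y)-component is j: unfolding decrements that component
-- and resets the larger ones to |W|, which are the indices of the μ-variables
-- bound in c outside the scope of a ν, while the smaller components, which
-- belong to the μ-variables free in c, are left alone.  Alternation freedom
-- makes ν-formulae non-deferrals, so they never need a timeout.

open import Defs
open import Data.Bool using (Bool; true; false; not; _∧_; _∨_; if_then_else_)
open import Data.Bool.ListAction using (all; any)
open import Data.Empty using (⊥; ⊥-elim)
open import Data.Fin using (Fin)
open import Data.Fin.Subset using (_⊆_; _⊂_; ∣_∣) renaming (_∈_ to _∈ₛ_)
open import Data.Fin.Subset.Properties
  using (x∈p∩q⁻; x∈p∩q⁺; x∈p∪q⁻; x∈p∪q⁺; ∉⊥; ⊆-refl; ⊆-reflexive; ⊆-trans; ⊆-antisym; ⊥⊆; ⊆⊤; _⊂?_; p⊂q⇒∣p∣<∣q∣; ∣p∣≤n; ∣p∣≡n⇒p≡⊤)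
  renaming (_∈?_ to _∈ₛ?_)
open import Data.List using (List; []; _∷_; _++_; filter; foldr; map; allFin)
open import Data.List.Membership.Propositional using (_∈_; find; lose)
open import Data.List.Membership.Propositional.Properties using (∈-++⁺ˡ; ∈-++⁺ʳ; ∈-++⁻; ∈-filter⁺; ∈-filter⁻; ∈-allFin; ∈-concatMap⁺)
open import Data.List.Relation.Unary.All using (all?)
import Data.List.Relation.Unary.All as All
import Data.List.Relation.Unary.All.Properties as All
open import Data.List.Relation.Unary.AllPairs using ([]; _∷_)
open import Data.List.Relation.Unary.Any using (here; there; any?)
import Data.List.Relation.Unary.Any as Any
open import Data.List.Relation.Unary.Unique.Propositional using (Unique)
open import Data.Maybe using (Maybe; just; nothing; _<∣>_; fromMaybe; maybe′)
open import Data.Nat using (ℕ; zero; suc; _+_; _∸_; _≤_; _<_; _≡ᵇ_; _⊔_; z≤n; s≤s)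
open import Data.Nat.Properties using (_≟_; 0≢1+n; ≤-refl; ≤-trans; ≤-antisym; <-≤-trans; m≤m+n; m≤n⇒m≤1+n; m≤m⊔n; m≤n⊔m; +-mono-≤; +-monoˡ-≤; +-suc; +-identityʳ; m≤n+m; <⇒≱)
open import Data.Product using (∃; _×_; _,_; proj₁; proj₂; Σ-syntax)
import Data.Product as Prod
open import Data.Sum using (_⊎_; inj₁; inj₂; [_,_]′)
import Data.Sum as Sum
open import Data.Vec using (Vec; []; _∷_; lookup; tabulate; replicate; zipWith)
open import Data.Vec.Properties using (lookup∘tabulate; []=⇒lookup; lookup⇒[]=)
open import Data.Vec.Relation.Unary.All using (All; []; _∷_)
open import Function using (_∘_; case_of_)
open import Relation.Binary.Definitions using (DecidableEquality)
open import Relation.Binary.PropositionalEquality using (_≡_; _≢_; _≗_; refl; sym; trans; cong; cong₂; subst)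
open import Relation.Nullary using (¬_; Dec; yes; no; ¬?; proof; contradiction)
open import Relation.Nullary.Decidable using (map′; _×-dec_; _⊎-dec_)
open import Relation.Nullary.Reflects using (Reflects; ofʸ; ofⁿ)

≡ᵇ-reflects : ∀ m n → Reflects (m ≡ n) (m ≡ᵇ n)
≡ᵇ-reflects m n = proof (m ≟ n)

≡ᵇ-refl : ∀ n → (n ≡ᵇ n) ≡ true
≡ᵇ-refl n with n ≡ᵇ n | ≡ᵇ-reflects n n
... | true  | _        = refl
... | false | ofⁿ n≢n = ⊥-elim (n≢n refl)

≢⇒≡ᵇ-false : ∀ {m n} → m ≢ n → (m ≡ᵇ n) ≡ false
≢⇒≡ᵇ-false {m} {n} m≢n with m ≡ᵇ n | ≡ᵇ-reflects m n
... | true  | ofʸ m≡n = ⊥-elim (m≢n m≡n)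
... | false | _        = refl

≡ᵇ-true⇒≡ : ∀ {m n} → (m ≡ᵇ n) ≡ true → m ≡ n
≡ᵇ-true⇒≡ {m} {n} e with m ≡ᵇ n | ≡ᵇ-reflects m n
≡ᵇ-true⇒≡ refl | true | ofʸ m≡n = m≡n

∧-true : ∀ {x y} → x ∧ y ≡ true → x ≡ true × y ≡ true
∧-true {true} y≡true = refl , y≡true

∨-true : ∀ {x y} → x ∨ y ≡ true → x ≡ true ⊎ y ≡ true
∨-true {true}  _ = inj₁ refl
∨-true {false} y≡true = inj₂ y≡true

∨-trueˡ : ∀ {x} y → x ≡ true → x ∨ y ≡ true
∨-trueˡ _ refl = refl

∨-trueʳ : ∀ x {y} → y ≡ true → x ∨ y ≡ true
∨-trueʳ true  _ = refl
∨-trueʳ false y≡true = y≡true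

==⇒≡ : ∀ a b → (a == b) ≡ true → a ≡ b
==⇒≡ ff = λ
  { ff _ → refl
  ; tt () ; (lit _ _) () ; (and _ _) () ; (or _ _) () ; (dia _ _) () ; (box _ _) () ; (var _) () ; (mu _ _) () ; (nu _ _) () }
==⇒≡ tt = λ
  { tt _ → refl
  ; ff () ; (lit _ _) () ; (and _ _) () ; (or _ _) () ; (dia _ _) () ; (box _ _) () ; (var _) () ; (mu _ _) () ; (nu _ _) () }
==⇒≡ (lit true p) = λ
  { (lit true q) e → cong (lit true) (≡ᵇ-true⇒≡ e)
  ; (lit false _) () ; ff () ; tt () ; (and _ _) () ; (or _ _) () ; (dia _ _) () ; (box _ _) () ; (var _) () ; (mu _ _) () ; (nu _ _) () }
==⇒≡ (lit false p) = λ
  { (lit false q) e → cong (lit false) (≡ᵇ-true⇒≡ e)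
  ; (lit true _) () ; ff () ; tt () ; (and _ _) () ; (or _ _) () ; (dia _ _) () ; (box _ _) () ; (var _) () ; (mu _ _) () ; (nu _ _) () }
==⇒≡ (and a b) = λ
  { (and c d) e → cong₂ and (==⇒≡ a c (proj₁ (∧-true e))) (==⇒≡ b d (proj₂ (∧-true e)))
  ; ff () ; tt () ; (lit _ _) () ; (or _ _) () ; (dia _ _) () ; (box _ _) () ; (var _) () ; (mu _ _) () ; (nu _ _) () }
==⇒≡ (or a b) = λ
  { (or c d) e → cong₂ or (==⇒≡ a c (proj₁ (∧-true e))) (==⇒≡ b d (proj₂ (∧-true e)))
  ; ff () ; tt () ; (lit _ _) () ; (and _ _) () ; (dia _ _) () ; (box _ _) () ; (var _) () ; (mu _ _) () ; (nu _ _) () }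
==⇒≡ (dia x a) = λ
  { (dia y b) e → cong₂ dia (≡ᵇ-true⇒≡ (proj₁ (∧-true e))) (==⇒≡ a b (proj₂ (∧-true e)))
  ; ff () ; tt () ; (lit _ _) () ; (and _ _) () ; (or _ _) () ; (box _ _) () ; (var _) () ; (mu _ _) () ; (nu _ _) () }
==⇒≡ (box x a) = λ
  { (box y b) e → cong₂ box (≡ᵇ-true⇒≡ (proj₁ (∧-true e))) (==⇒≡ a b (proj₂ (∧-true e)))
  ; ff () ; tt () ; (lit _ _) () ; (and _ _) () ; (or _ _) () ; (dia _ _) () ; (var _) () ; (mu _ _) () ; (nu _ _) () }
==⇒≡ (var x) = λ
  { (var y) e → cong var (≡ᵇ-true⇒≡ e)
  ; ff () ; tt () ; (lit _ _) () ; (and _ _) () ; (or _ _) () ; (dia _ _) () ; (box _ _) () ; (mu _ _) () ; (nu _ _) () }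
==⇒≡ (mu x a) = λ
  { (mu y b) e → cong₂ mu (≡ᵇ-true⇒≡ (proj₁ (∧-true e))) (==⇒≡ a b (proj₂ (∧-true e)))
  ; ff () ; tt () ; (lit _ _) () ; (and _ _) () ; (or _ _) () ; (dia _ _) () ; (box _ _) () ; (var _) () ; (nu _ _) () }
==⇒≡ (nu x a) = λ
  { (nu y b) e → cong₂ nu (≡ᵇ-true⇒≡ (proj₁ (∧-true e))) (==⇒≡ a b (proj₂ (∧-true e)))
  ; ff () ; tt () ; (lit _ _) () ; (and _ _) () ; (or _ _) () ; (dia _ _) () ; (box _ _) () ; (var _) () ; (mu _ _) () }

==-refl : ∀ a → (a == a) ≡ true
==-refl ff = refl
==-refl tt = refl
==-refl (lit true p) = ≡ᵇ-refl p
==-refl (lit false p) = ≡ᵇ-refl p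
==-refl (and a b) rewrite ==-refl a | ==-refl b = refl
==-refl (or a b) rewrite ==-refl a | ==-refl b = refl
==-refl (dia x a) rewrite ≡ᵇ-refl x | ==-refl a = refl
==-refl (box x a) rewrite ≡ᵇ-refl x | ==-refl a = refl
==-refl (var x) = ≡ᵇ-refl x
==-refl (mu x a) rewrite ≡ᵇ-refl x | ==-refl a = refl
==-refl (nu x a) rewrite ≡ᵇ-refl x | ==-refl a = refl

_≟F_ : DecidableEquality Fm
a ≟F b with a == b in e
... | true  = yes (==⇒≡ a b e)
... | false = no λ { refl → contradiction (trans (sym e) (==-refl a)) λ () }

sub-fresh : ∀ t u X → ¬ FreeIn X t → sub t u X ≡ t
sub-fresh ff u X _ = refl
sub-fresh tt u X _ = refl
sub-fresh (lit b p) u X _ = refl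
sub-fresh (and a b) u X ∉ = cong₂ and (sub-fresh a u X (∉ ∘ fandl)) (sub-fresh b u X (∉ ∘ fandr))
sub-fresh (or a b) u X ∉ = cong₂ or (sub-fresh a u X (∉ ∘ forl)) (sub-fresh b u X (∉ ∘ forr))
sub-fresh (dia x a) u X ∉ = cong (dia x) (sub-fresh a u X (∉ ∘ fdia))
sub-fresh (box x a) u X ∉ = cong (box x) (sub-fresh a u X (∉ ∘ fbox))
sub-fresh (var Y) u X ∉ with Y ≡ᵇ X | ≡ᵇ-reflects Y X
... | true  | ofʸ refl = ⊥-elim (∉ fvar)
... | false | _        = refl
sub-fresh (mu Y a) u X ∉ with Y ≡ᵇ X | ≡ᵇ-reflects Y X
... | true  | _        = refl
... | false | ofⁿ Y≢X = cong (mu Y) (sub-fresh a u X (∉ ∘ fmu Y≢X))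
sub-fresh (nu Y a) u X ∉ with Y ≡ᵇ X | ≡ᵇ-reflects Y X
... | true  | _        = refl
... | false | ofⁿ Y≢X = cong (nu Y) (sub-fresh a u X (∉ ∘ fnu Y≢X))

Subst : Set
Subst = ℕ → Maybe Fm

∅ : Subst
∅ _ = nothing

_∖_ : Subst → ℕ → Subst
(s ∖ Y) Z = if Z ≡ᵇ Y then nothing else s Z

_[_↦_] : Subst → ℕ → Fm → Subst
(s [ Y ↦ t ]) Z = if Z ≡ᵇ Y then just t else s Z

psub : Fm → Subst → Fm
psub ff s = ff
psub tt s = tt
psub (lit b p) s = lit b p
psub (and a b) s = and (psub a s) (psub b s)
psub (or a b) s = or (psub a s) (psub b s)
psub (dia x a) s = dia x (psub a s)
psub (box x a) s = box x (psub a s)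
psub (var Z) s = fromMaybe (var Z) (s Z)
psub (mu Y a) s = mu Y (psub a (s ∖ Y))
psub (nu Y a) s = nu Y (psub a (s ∖ Y))

ClosedSubst : Subst → Set
ClosedSubst s = ∀ Z t → s Z ≡ just t → Closed t

↦-same : ∀ s Y t → (s [ Y ↦ t ]) Y ≡ just t
↦-same s Y t rewrite ≡ᵇ-refl Y = refl

↦-other : ∀ s {Y Z} t → Z ≢ Y → (s [ Y ↦ t ]) Z ≡ s Z
↦-other s t Z≢Y rewrite ≢⇒≡ᵇ-false Z≢Y = refl

∖-same : ∀ s Y → (s ∖ Y) Y ≡ nothing
∖-same s Y rewrite ≡ᵇ-refl Y = refl

∖-other : ∀ s {Y Z} → Z ≢ Y → (s ∖ Y) Z ≡ s Z
∖-other s Z≢Y rewrite ≢⇒≡ᵇ-false Z≢Y = refl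

∖↦-other : ∀ s {Y Z} t → Z ≢ Y → ((s ∖ Y) [ Y ↦ t ]) Z ≡ s Z
∖↦-other s {Y} t Z≢Y = trans (↦-other (s ∖ Y) t Z≢Y) (∖-other s Z≢Y)

∖-cong : ∀ {s s′} Y → s ≗ s′ → (s ∖ Y) ≗ (s′ ∖ Y)
∖-cong Y s≗s′ Z with Z ≡ᵇ Y
... | true  = refl
... | false = s≗s′ Z

∖-∅ : ∀ Y → (∅ ∖ Y) ≗ ∅
∖-∅ Y Z with Z ≡ᵇ Y
... | true  = refl
... | false = refl

↦-∖-same : ∀ s Y t → ((s [ Y ↦ t ]) ∖ Y) ≗ (s ∖ Y)
↦-∖-same s Y t Z with Z ≡ᵇ Y
... | true  = refl
... | false = refl

↦-∖-comm : ∀ s {Y Z} t → Z ≢ Y → ((s ∖ Z) [ Y ↦ t ]) ≗ ((s [ Y ↦ t ]) ∖ Z)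
↦-∖-comm s {Y} {Z} t Z≢Y W with W ≡ᵇ Y | ≡ᵇ-reflects W Y | W ≡ᵇ Z | ≡ᵇ-reflects W Z
... | true  | ofʸ refl | true  | ofʸ refl = ⊥-elim (Z≢Y refl)
... | true  | _        | false | _        = refl
... | false | _        | true  | _        = refl
... | false | _        | false | _        = refl

∖-closed : ∀ {s} Y → ClosedSubst s → ClosedSubst (s ∖ Y)
∖-closed {s} Y cs Z t e with Z ≡ᵇ Y
... | false = cs Z t e

↦-closed : ∀ {s} Y {t} → Closed t → ClosedSubst s → ClosedSubst (s [ Y ↦ t ])
↦-closed {s} Y ct cs Z u e with Z ≡ᵇ Y
↦-closed {s} Y ct cs Z u refl | true = ct
... | false = cs Z u e

psub-cong : ∀ a {s s′} → s ≗ s′ → psub a s ≡ psub a s′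
psub-cong ff _ = refl
psub-cong tt _ = refl
psub-cong (lit b q) _ = refl
psub-cong (and a b) p = cong₂ and (psub-cong a p) (psub-cong b p)
psub-cong (or a b) p = cong₂ or (psub-cong a p) (psub-cong b p)
psub-cong (dia x a) p = cong (dia x) (psub-cong a p)
psub-cong (box x a) p = cong (box x) (psub-cong a p)
psub-cong (var Z) p = cong (fromMaybe (var Z)) (p Z)
psub-cong (mu Y a) p = cong (mu Y) (psub-cong a (∖-cong Y p))
psub-cong (nu Y a) p = cong (nu Y) (psub-cong a (∖-cong Y p))

psub-∅ : ∀ a → psub a ∅ ≡ a
psub-∅ ff = refl
psub-∅ tt = refl
psub-∅ (lit b p) = refl
psub-∅ (and a b) = cong₂ and (psub-∅ a) (psub-∅ b)
psub-∅ (or a b) = cong₂ or (psub-∅ a) (psub-∅ b)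
psub-∅ (dia x a) = cong (dia x) (psub-∅ a)
psub-∅ (box x a) = cong (box x) (psub-∅ a)
psub-∅ (var Z) = refl
psub-∅ (mu Y a) = cong (mu Y) (trans (psub-cong a (∖-∅ Y)) (psub-∅ a))
psub-∅ (nu Y a) = cong (nu Y) (trans (psub-cong a (∖-∅ Y)) (psub-∅ a))

sub-psub : ∀ a {s} Y t → ClosedSubst s → s Y ≡ nothing
         → sub (psub a s) t Y ≡ psub a (s [ Y ↦ t ])
sub-psub ff Y t cs sY = refl
sub-psub tt Y t cs sY = refl
sub-psub (lit b p) Y t cs sY = refl
sub-psub (and a b) Y t cs sY = cong₂ and (sub-psub a Y t cs sY) (sub-psub b Y t cs sY)
sub-psub (or a b) Y t cs sY = cong₂ or (sub-psub a Y t cs sY) (sub-psub b Y t cs sY)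
sub-psub (dia x a) Y t cs sY = cong (dia x) (sub-psub a Y t cs sY)
sub-psub (box x a) Y t cs sY = cong (box x) (sub-psub a Y t cs sY)
sub-psub (var Z) {s} Y t cs sY with Z ≡ᵇ Y | ≡ᵇ-reflects Z Y
... | true  | ofʸ refl rewrite sY | ≡ᵇ-refl Z = refl
... | false | ofⁿ Z≢Y with s Z in sZ
...   | just u  = sub-fresh u t Y (cs Z u sZ Y)
...   | nothing rewrite ≢⇒≡ᵇ-false Z≢Y = refl
sub-psub (mu Z a) {s} Y t cs sY with Z ≡ᵇ Y | ≡ᵇ-reflects Z Y
... | true  | ofʸ refl = cong (mu Z) (psub-cong a (λ W → sym (↦-∖-same s Z t W)))
... | false | ofⁿ Z≢Y = cong (mu Z) (trans
      (sub-psub a Y t (∖-closed Z cs) (trans (∖-other s (Z≢Y ∘ sym)) sY))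
      (psub-cong a (↦-∖-comm s t Z≢Y)))
sub-psub (nu Z a) {s} Y t cs sY with Z ≡ᵇ Y | ≡ᵇ-reflects Z Y
... | true  | ofʸ refl = cong (nu Z) (psub-cong a (λ W → sym (↦-∖-same s Z t W)))
... | false | ofⁿ Z≢Y = cong (nu Z) (trans
      (sub-psub a Y t (∖-closed Z cs) (trans (∖-other s (Z≢Y ∘ sym)) sY))
      (psub-cong a (↦-∖-comm s t Z≢Y)))

free-psub : ∀ a {s} X → ClosedSubst s → FreeIn X (psub a s) → FreeIn X a × s X ≡ nothing
free-psub (and a b) X cs (fandl f) = Prod.map₁ fandl (free-psub a X cs f)
free-psub (and a b) X cs (fandr f) = Prod.map₁ fandr (free-psub b X cs f)
free-psub (or a b) X cs (forl f) = Prod.map₁ forl (free-psub a X cs f)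
free-psub (or a b) X cs (forr f) = Prod.map₁ forr (free-psub b X cs f)
free-psub (dia x a) X cs (fdia f) = Prod.map₁ fdia (free-psub a X cs f)
free-psub (box x a) X cs (fbox f) = Prod.map₁ fbox (free-psub a X cs f)
free-psub (var Z) {s} X cs f with s Z in sZ
free-psub (var Z) {s} X cs f    | just u  = ⊥-elim (cs Z u sZ X f)
free-psub (var Z) {s} X cs fvar | nothing = fvar , sZ
free-psub (mu Y a) {s} X cs (fmu Y≢X f) =
  Prod.map (fmu Y≢X) (trans (sym (∖-other s (Y≢X ∘ sym)))) (free-psub a X (∖-closed Y cs) f)
free-psub (nu Y a) {s} X cs (fnu Y≢X f) =
  Prod.map (fnu Y≢X) (trans (sym (∖-other s (Y≢X ∘ sym)))) (free-psub a X (∖-closed Y cs) f)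

psub-closed : ∀ a {s} → ClosedSubst s → (∀ X → FreeIn X a → ∃ λ t → s X ≡ just t) → Closed (psub a s)
psub-closed a cs covers X f with free-psub a X cs f
... | f′ , sX with covers X f′
... | t , sX′ with trans (sym sX) sX′
... | ()

-- Deciding deferrals

∃-listed? : ∀ {A : Set} {P : A → Set} (xs : List A) → (∀ {x} → P x → x ∈ xs)
          → (∀ x → Dec (P x)) → Dec (∃ P)
∃-listed? xs complete P? =
  map′ (λ a → let x , _ , px = find a in x , px) (λ (x , px) → lose (complete px) px) (any? P? xs)

size : Fm → ℕ
size (and a b) = suc (size a + size b)
size (or a b) = suc (size a + size b)
size (dia x a) = suc (size a)
size (box x a) = suc (size a)
size (mu Y a) = suc (size a)
size (nu Y a) = suc (size a)
size _ = 1

size-pos : ∀ a → 1 ≤ size a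
size-pos ff = s≤s z≤n
size-pos tt = s≤s z≤n
size-pos (lit b p) = s≤s z≤n
size-pos (and a b) = s≤s z≤n
size-pos (or a b) = s≤s z≤n
size-pos (dia x a) = s≤s z≤n
size-pos (box x a) = s≤s z≤n
size-pos (var Z) = s≤s z≤n
size-pos (mu Y a) = s≤s z≤n
size-pos (nu Y a) = s≤s z≤n

size≤size-sub : ∀ χ b X → size χ ≤ size (sub χ b X)
size≤size-sub ff b X = ≤-refl
size≤size-sub tt b X = ≤-refl
size≤size-sub (lit c p) b X = ≤-refl
size≤size-sub (and a c) b X = s≤s (+-mono-≤ (size≤size-sub a b X) (size≤size-sub c b X))
size≤size-sub (or a c) b X = s≤s (+-mono-≤ (size≤size-sub a b X) (size≤size-sub c b X))
size≤size-sub (dia x a) b X = s≤s (size≤size-sub a b X)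
size≤size-sub (box x a) b X = s≤s (size≤size-sub a b X)
size≤size-sub (var Y) b X with Y ≡ᵇ X
... | true  = size-pos b
... | false = ≤-refl
size≤size-sub (mu Y a) b X with Y ≡ᵇ X
... | true  = ≤-refl
... | false = s≤s (size≤size-sub a b X)
size≤size-sub (nu Y a) b X with Y ≡ᵇ X
... | true  = ≤-refl
... | false = s≤s (size≤size-sub a b X)

size<size-sub : ∀ χ b X → FreeIn X χ → 2 ≤ size b → size χ < size (sub χ b X)
size<size-sub (and a c) b X (fandl f) 2≤b = s≤s (+-mono-≤ (size<size-sub a b X f 2≤b) (size≤size-sub c b X))
size<size-sub (and a c) b X (fandr f) 2≤b =
  s≤s (subst (_≤ size (sub a b X) + size (sub c b X)) (+-suc (size a) (size c)) (+-mono-≤ (size≤size-sub a b X) (size<size-sub c b X f 2≤b)))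
size<size-sub (or a c) b X (forl f) 2≤b = s≤s (+-mono-≤ (size<size-sub a b X f 2≤b) (size≤size-sub c b X))
size<size-sub (or a c) b X (forr f) 2≤b =
  s≤s (subst (_≤ size (sub a b X) + size (sub c b X)) (+-suc (size a) (size c)) (+-mono-≤ (size≤size-sub a b X) (size<size-sub c b X f 2≤b)))
size<size-sub (dia x a) b X (fdia f) 2≤b = s≤s (size<size-sub a b X f 2≤b)
size<size-sub (box x a) b X (fbox f) 2≤b = s≤s (size<size-sub a b X f 2≤b)
size<size-sub (var Y) b X fvar 2≤b rewrite ≡ᵇ-refl X = 2≤b
size<size-sub (mu Y a) b X (fmu Y≢X f) 2≤b rewrite ≢⇒≡ᵇ-false Y≢X = s≤s (size<size-sub a b X f 2≤b)
size<size-sub (nu Y a) b X (fnu Y≢X f) 2≤b rewrite ≢⇒≡ᵇ-false Y≢X = s≤s (size<size-sub a b X f 2≤b)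

data BinderOf (X : ℕ) : Fm → Set where
  bmu : ∀ a → BinderOf X (mu X a)
  bnu : ∀ a → BinderOf X (nu X a)

binder-size : ∀ {X b} → BinderOf X b → 2 ≤ size b
binder-size (bmu a) = s≤s (size-pos a)
binder-size (bnu a) = s≤s (size-pos a)

<∣>-just : ∀ {A : Set} (x y : Maybe A) {b} → (x <∣> y) ≡ just b → x ≡ just b ⊎ (x ≡ nothing × y ≡ just b)
<∣>-just (just a) y e = inj₁ e
<∣>-just nothing y e = inj₂ (refl , e)

findB-binder : ∀ X φ {b} → findB X φ ≡ just b → BinderOf X b
findB-binder X (and a c) e with <∣>-just (findB X a) (findB X c) e
... | inj₁ e′ = findB-binder X a e′
... | inj₂ (_ , e′) = findB-binder X c e′
findB-binder X (or a c) e with <∣>-just (findB X a) (findB X c) e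
... | inj₁ e′ = findB-binder X a e′
... | inj₂ (_ , e′) = findB-binder X c e′
findB-binder X (dia x a) e = findB-binder X a e
findB-binder X (box x a) e = findB-binder X a e
findB-binder X (mu Y a) e with Y ≡ᵇ X | ≡ᵇ-reflects Y X
findB-binder X (mu Y a) refl | true  | ofʸ refl = bmu a
...                          | false | _        = findB-binder X a e
findB-binder X (nu Y a) e with Y ≡ᵇ X | ≡ᵇ-reflects Y X
findB-binder X (nu Y a) refl | true  | ofʸ refl = bnu a
...                          | false | _        = findB-binder X a e

freeVars : Fm → List ℕ
freeVars (and a b) = freeVars a ++ freeVars b
freeVars (or a b) = freeVars a ++ freeVars b
freeVars (dia x a) = freeVars a
freeVars (box x a) = freeVars a
freeVars (var Z) = Z ∷ []
freeVars (mu Y a) = filter (λ Z → ¬? (Z ≟ Y)) (freeVars a)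
freeVars (nu Y a) = filter (λ Z → ¬? (Z ≟ Y)) (freeVars a)
freeVars _ = []

∈-freeVars⁺ : ∀ {X} φ → FreeIn X φ → X ∈ freeVars φ
∈-freeVars⁺ (and a b) (fandl f) = ∈-++⁺ˡ (∈-freeVars⁺ a f)
∈-freeVars⁺ (and a b) (fandr f) = ∈-++⁺ʳ (freeVars a) (∈-freeVars⁺ b f)
∈-freeVars⁺ (or a b) (forl f) = ∈-++⁺ˡ (∈-freeVars⁺ a f)
∈-freeVars⁺ (or a b) (forr f) = ∈-++⁺ʳ (freeVars a) (∈-freeVars⁺ b f)
∈-freeVars⁺ (dia x a) (fdia f) = ∈-freeVars⁺ a f
∈-freeVars⁺ (box x a) (fbox f) = ∈-freeVars⁺ a f
∈-freeVars⁺ (var Z) fvar = here refl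
∈-freeVars⁺ (mu Y a) (fmu Y≢X f) = ∈-filter⁺ (λ Z → ¬? (Z ≟ Y)) (∈-freeVars⁺ a f) (Y≢X ∘ sym)
∈-freeVars⁺ (nu Y a) (fnu Y≢X f) = ∈-filter⁺ (λ Z → ¬? (Z ≟ Y)) (∈-freeVars⁺ a f) (Y≢X ∘ sym)

∈-freeVars⁻ : ∀ {X} φ → X ∈ freeVars φ → FreeIn X φ
∈-freeVars⁻ (and a b) m with ∈-++⁻ (freeVars a) m
... | inj₁ m′ = fandl (∈-freeVars⁻ a m′)
... | inj₂ m′ = fandr (∈-freeVars⁻ b m′)
∈-freeVars⁻ (or a b) m with ∈-++⁻ (freeVars a) m
... | inj₁ m′ = forl (∈-freeVars⁻ a m′)
... | inj₂ m′ = forr (∈-freeVars⁻ b m′)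
∈-freeVars⁻ (dia x a) m = fdia (∈-freeVars⁻ a m)
∈-freeVars⁻ (box x a) m = fbox (∈-freeVars⁻ a m)
∈-freeVars⁻ (var Z) (here refl) = fvar
∈-freeVars⁻ (mu Y a) m with ∈-filter⁻ (λ Z → ¬? (Z ≟ Y)) {xs = freeVars a} m
... | m′ , X≢Y = fmu (X≢Y ∘ sym) (∈-freeVars⁻ a m′)
∈-freeVars⁻ (nu Y a) m with ∈-filter⁻ (λ Z → ¬? (Z ≟ Y)) {xs = freeVars a} m
... | m′ , X≢Y = fnu (X≢Y ∘ sym) (∈-freeVars⁻ a m′)

∀-free? : ∀ φ {Q : ℕ → Set} → (∀ X → Dec (Q X)) → Dec (∀ X → FreeIn X φ → Q X)
∀-free? φ Q? =
  map′ (λ all X f → All.lookup all (∈-freeVars⁺ φ f)) (λ h → All.tabulate (h _ ∘ ∈-freeVars⁻ φ))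
       (all? Q? (freeVars φ))

freeIn? : ∀ X φ → Dec (FreeIn X φ)
freeIn? X φ = map′ (∈-freeVars⁻ φ) (∈-freeVars⁺ φ) (any? (X ≟_) (freeVars φ))

closed? : ∀ φ → Dec (Closed φ)
closed? φ = ∀-free? φ (λ _ → no λ ())

subformulas : Fm → List Fm
subformulas φ = φ ∷ proper φ
  where
  proper : Fm → List Fm
  proper (and a b) = subformulas a ++ subformulas b
  proper (or a b) = subformulas a ++ subformulas b
  proper (dia x a) = subformulas a
  proper (box x a) = subformulas a
  proper (mu Y a) = subformulas a
  proper (nu Y a) = subformulas a
  proper _ = []

∈-subformulas⁺ : ∀ {χ} φ → SubF χ φ → χ ∈ subformulas φ
∈-subformulas⁺ φ sref = here refl
∈-subformulas⁺ (and a b) (sandl p) = there (∈-++⁺ˡ (∈-subformulas⁺ a p))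
∈-subformulas⁺ (and a b) (sandr p) = there (∈-++⁺ʳ (subformulas a) (∈-subformulas⁺ b p))
∈-subformulas⁺ (or a b) (sorl p) = there (∈-++⁺ˡ (∈-subformulas⁺ a p))
∈-subformulas⁺ (or a b) (sorr p) = there (∈-++⁺ʳ (subformulas a) (∈-subformulas⁺ b p))
∈-subformulas⁺ (dia x a) (sdia p) = there (∈-subformulas⁺ a p)
∈-subformulas⁺ (box x a) (sbox p) = there (∈-subformulas⁺ a p)
∈-subformulas⁺ (mu Y a) (smu p) = there (∈-subformulas⁺ a p)
∈-subformulas⁺ (nu Y a) (snu p) = there (∈-subformulas⁺ a p)

∈-subformulas⁻ : ∀ {χ} φ → χ ∈ subformulas φ → SubF χ φ
∈-subformulas⁻ φ (here refl) = sref
∈-subformulas⁻ (and a b) (there m) with ∈-++⁻ (subformulas a) m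
... | inj₁ m′ = sandl (∈-subformulas⁻ a m′)
... | inj₂ m′ = sandr (∈-subformulas⁻ b m′)
∈-subformulas⁻ (or a b) (there m) with ∈-++⁻ (subformulas a) m
... | inj₁ m′ = sorl (∈-subformulas⁻ a m′)
... | inj₂ m′ = sorr (∈-subformulas⁻ b m′)
∈-subformulas⁻ (dia x a) (there m) = sdia (∈-subformulas⁻ a m)
∈-subformulas⁻ (box x a) (there m) = sbox (∈-subformulas⁻ a m)
∈-subformulas⁻ (mu Y a) (there m) = smu (∈-subformulas⁻ a m)
∈-subformulas⁻ (nu Y a) (there m) = snu (∈-subformulas⁻ a m)

subF? : ∀ χ φ → Dec (SubF χ φ)
subF? χ φ = map′ (∈-subformulas⁻ φ) (∈-subformulas⁺ φ) (any? (χ ≟F_) (subformulas φ))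

module DeferralDecision (ρ1 ρ0 : Fm) where

  theta-binder : ∀ X {b} → theta ρ1 ρ0 X ≡ just b → BinderOf X b
  theta-binder X e with <∣>-just (findB X ρ1) (findB X ρ0) e
  ... | inj₁ e′ = findB-binder X ρ1 e′
  ... | inj₂ (_ , e′) = findB-binder X ρ0 e′

  Clf-size : ∀ {χ φ} → Clf ρ1 ρ0 χ φ → size χ ≤ size φ
  Clf-size (clf-done _) = ≤-refl
  Clf-size (clf-step {χ} {X = X} {b} _ _ _ c) = ≤-trans (size≤size-sub χ b X) (Clf-size c)

  Innermost : Fm → ℕ → Fm → Set
  Innermost χ X b = ∀ Y → FreeIn Y χ → Y ≢ X → ∃ λ b′ → theta ρ1 ρ0 Y ≡ just b′ × SubF b b′

  innermost? : ∀ χ X b → Dec (Innermost χ X b)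
  innermost? χ X b = ∀-free? χ λ Y → unless (Y ≟ X) (binder-above? Y)
    where
    unless : ∀ {A B : Set} → Dec A → Dec B → Dec (¬ A → B)
    unless (yes a) _ = yes λ ¬a → ⊥-elim (¬a a)
    unless (no ¬a) B? = map′ (λ b _ → b) (λ f → f ¬a) B?
    binder-above? : ∀ Y → Dec (∃ λ b′ → theta ρ1 ρ0 Y ≡ just b′ × SubF b b′)
    binder-above? Y with theta ρ1 ρ0 Y
    ... | nothing = no λ ()
    ... | just b′ = map′ (λ p → b′ , refl , p) (λ { (_ , refl , p) → p }) (subF? b b′)

  ClfStep : Fm → Fm → ℕ → Set
  ClfStep χ φ X = FreeIn X χ × ∃ λ b → theta ρ1 ρ0 X ≡ just b × Innermost χ X b × Clf ρ1 ρ0 (sub χ b X) φ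

  -- Every step of Clf substitutes a binder (of size ≥ 2) for a free variable and so
  -- strictly increases the size; hence the fuel bounds the length of a derivation.
  clf-within : ∀ fuel χ φ → size φ < size χ + fuel → Dec (Clf ρ1 ρ0 χ φ)
  clf-within zero χ φ φ<χ = no λ c → <⇒≱ (subst (size φ <_) (+-identityʳ _) φ<χ) (Clf-size c)
  clf-within (suc fuel) χ φ φ<χ with closed? χ
  ... | yes cl = map′ (λ { refl → clf-done cl })
                      (λ { (clf-done _) → refl ; (clf-step f _ _ _) → ⊥-elim (cl _ f) }) (χ ≟F φ)
  ... | no ¬cl = map′ from-step to-step (∃-listed? (freeVars χ) (∈-freeVars⁺ χ ∘ proj₁) step?)
    where
    from-step : ∃ (ClfStep χ φ) → Clf ρ1 ρ0 χ φ
    from-step (X , f , b , θX , inn , c) = clf-step f θX inn c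
    to-step : Clf ρ1 ρ0 χ φ → ∃ (ClfStep χ φ)
    to-step (clf-done cl) = ⊥-elim (¬cl cl)
    to-step (clf-step f θX inn c) = _ , f , _ , θX , inn , c
    step? : ∀ X → Dec (ClfStep χ φ X)
    step? X with freeIn? X χ | theta ρ1 ρ0 X in θX
    ... | no ¬f | _       = no (¬f ∘ proj₁)
    ... | yes f | nothing = no λ { (_ , _ , () , _) }
    ... | yes f | just b  = map′ (λ (inn , c) → f , b , refl , inn , c) (λ { (_ , _ , refl , inn , c) → inn , c })
                                 (innermost? χ X b ×-dec clf-within fuel (sub χ b X) φ φ<χ[b/X])
      where
      φ<χ[b/X] : size φ < size (sub χ b X) + fuel
      φ<χ[b/X] = <-≤-trans (subst (size φ <_) (+-suc (size χ) fuel) φ<χ)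
                           (+-monoˡ-≤ fuel (size<size-sub χ b X f (binder-size (theta-binder X θX))))

  clf? : ∀ χ φ → Dec (Clf ρ1 ρ0 χ φ)
  clf? χ φ = clf-within (suc (size φ)) χ φ (m≤n+m (suc (size φ)) (size χ))

  isMu? : ∀ X → Dec (IsMu ρ1 ρ0 X)
  isMu? X with theta ρ1 ρ0 X in θX
  ... | nothing = no λ ()
  ... | just b with theta-binder X θX
  ...   | bmu a = yes (a , refl)
  ...   | bnu a = no λ ()

  dfr? : ∀ φ → InCL ρ1 ρ0 φ → Dec (Dfr ρ1 ρ0 φ)
  dfr? φ icl = map′ (icl ,_) proj₂ (∃-listed? (subformulas ρ1 ++ subformulas ρ0) listed candidate?)
    where
    Candidate : Fm → Set
    Candidate χ = SubAny ρ1 ρ0 χ × (∃ λ X → FreeIn X χ × IsMu ρ1 ρ0 X) × Clf ρ1 ρ0 χ φ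
    listed : ∀ {χ} → Candidate χ → χ ∈ subformulas ρ1 ++ subformulas ρ0
    listed (inj₁ s , _) = ∈-++⁺ˡ (∈-subformulas⁺ ρ1 s)
    listed (inj₂ s , _) = ∈-++⁺ʳ (subformulas ρ1) (∈-subformulas⁺ ρ0 s)
    candidate? : ∀ χ → Dec (Candidate χ)
    candidate? χ = (subF? χ ρ1 ⊎-dec subF? χ ρ0)
             ×-dec ∃-listed? (freeVars χ) (∈-freeVars⁺ χ ∘ proj₁) (λ X → freeIn? X χ ×-dec isMu? X)
             ×-dec clf? χ φ

Unique-++⁻ˡ : ∀ (xs : List ℕ) {ys} → Unique (xs ++ ys) → Unique xs
Unique-++⁻ˡ [] _ = []
Unique-++⁻ˡ (x ∷ xs) (x∉ ∷ u) = All.++⁻ˡ xs x∉ ∷ Unique-++⁻ˡ xs u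

Unique-++⁻ʳ : ∀ (xs : List ℕ) {ys} → Unique (xs ++ ys) → Unique ys
Unique-++⁻ʳ [] u = u
Unique-++⁻ʳ (x ∷ xs) (_ ∷ u) = Unique-++⁻ʳ xs u

Unique-++-disjoint : ∀ (xs : List ℕ) {ys x} → Unique (xs ++ ys) → x ∈ xs → x ∈ ys → ⊥
Unique-++-disjoint (x ∷ xs) (x∉ ∷ _) (here refl) x∈ys = All.lookup x∉ (∈-++⁺ʳ xs x∈ys) refl
Unique-++-disjoint (x ∷ xs) (_ ∷ u) (there m) x∈ys = Unique-++-disjoint xs u m x∈ys

binder∈boundVars : ∀ {Y b} φ → SubF b φ → BinderOf Y b → Y ∈ boundVars φ
binder∈boundVars (mu Z a) sref (bmu a) = here refl
binder∈boundVars (nu Z a) sref (bnu a) = here refl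
binder∈boundVars (and a c) (sandl p) bY = ∈-++⁺ˡ (binder∈boundVars a p bY)
binder∈boundVars (and a c) (sandr p) bY = ∈-++⁺ʳ (boundVars a) (binder∈boundVars c p bY)
binder∈boundVars (or a c) (sorl p) bY = ∈-++⁺ˡ (binder∈boundVars a p bY)
binder∈boundVars (or a c) (sorr p) bY = ∈-++⁺ʳ (boundVars a) (binder∈boundVars c p bY)
binder∈boundVars (dia x a) (sdia p) bY = binder∈boundVars a p bY
binder∈boundVars (box x a) (sbox p) bY = binder∈boundVars a p bY
binder∈boundVars (mu Z a) (smu p) bY = there (binder∈boundVars a p bY)
binder∈boundVars (nu Z a) (snu p) bY = there (binder∈boundVars a p bY)

findB-unbound : ∀ Y φ → ¬ Y ∈ boundVars φ → findB Y φ ≡ nothing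
findB-unbound Y (and a c) ∉ rewrite findB-unbound Y a (∉ ∘ ∈-++⁺ˡ) = findB-unbound Y c (∉ ∘ ∈-++⁺ʳ (boundVars a))
findB-unbound Y (or a c) ∉ rewrite findB-unbound Y a (∉ ∘ ∈-++⁺ˡ) = findB-unbound Y c (∉ ∘ ∈-++⁺ʳ (boundVars a))
findB-unbound Y (dia x a) ∉ = findB-unbound Y a ∉
findB-unbound Y (box x a) ∉ = findB-unbound Y a ∉
findB-unbound Y (mu Z a) ∉ with Z ≡ᵇ Y | ≡ᵇ-reflects Z Y
... | true  | ofʸ refl = ⊥-elim (∉ (here refl))
... | false | _        = findB-unbound Y a (∉ ∘ there)
findB-unbound Y (nu Z a) ∉ with Z ≡ᵇ Y | ≡ᵇ-reflects Z Y
... | true  | ofʸ refl = ⊥-elim (∉ (here refl))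
... | false | _        = findB-unbound Y a (∉ ∘ there)
findB-unbound Y ff _ = refl
findB-unbound Y tt _ = refl
findB-unbound Y (lit b p) _ = refl
findB-unbound Y (var Z) _ = refl

findB-unique : ∀ {Y b} φ → Unique (boundVars φ) → SubF b φ → BinderOf Y b → findB Y φ ≡ just b
findB-unique {Y} (mu Y a) _ sref (bmu a) rewrite ≡ᵇ-refl Y = refl
findB-unique {Y} (nu Y a) _ sref (bnu a) rewrite ≡ᵇ-refl Y = refl
findB-unique (and a c) u (sandl p) bY rewrite findB-unique a (Unique-++⁻ˡ (boundVars a) u) p bY = refl
findB-unique {Y} (and a c) u (sandr p) bY
  rewrite findB-unbound Y a (λ m → Unique-++-disjoint (boundVars a) u m (binder∈boundVars c p bY))
  = findB-unique c (Unique-++⁻ʳ (boundVars a) u) p bY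
findB-unique (or a c) u (sorl p) bY rewrite findB-unique a (Unique-++⁻ˡ (boundVars a) u) p bY = refl
findB-unique {Y} (or a c) u (sorr p) bY
  rewrite findB-unbound Y a (λ m → Unique-++-disjoint (boundVars a) u m (binder∈boundVars c p bY))
  = findB-unique c (Unique-++⁻ʳ (boundVars a) u) p bY
findB-unique (dia x a) u (sdia p) bY = findB-unique a u p bY
findB-unique (box x a) u (sbox p) bY = findB-unique a u p bY
findB-unique {Y} (mu Z a) (Z∉ ∷ u) (smu p) bY with Z ≡ᵇ Y | ≡ᵇ-reflects Z Y
... | true  | ofʸ refl = ⊥-elim (All.lookup Z∉ (binder∈boundVars a p bY) refl)
... | false | _        = findB-unique a u p bY
findB-unique {Y} (nu Z a) (Z∉ ∷ u) (snu p) bY with Z ≡ᵇ Y | ≡ᵇ-reflects Z Y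
... | true  | ofʸ refl = ⊥-elim (All.lookup Z∉ (binder∈boundVars a p bY) refl)
... | false | _        = findB-unique a u p bY

SubF-trans : ∀ {a b c} → SubF a b → SubF b c → SubF a c
SubF-trans p sref = p
SubF-trans p (sandl q) = sandl (SubF-trans p q)
SubF-trans p (sandr q) = sandr (SubF-trans p q)
SubF-trans p (sorl q) = sorl (SubF-trans p q)
SubF-trans p (sorr q) = sorr (SubF-trans p q)
SubF-trans p (sdia q) = sdia (SubF-trans p q)
SubF-trans p (sbox q) = sbox (SubF-trans p q)
SubF-trans p (smu q) = smu (SubF-trans p q)
SubF-trans p (snu q) = snu (SubF-trans p q)

SubF-size : ∀ {a b} → SubF a b → size a ≤ size b
SubF-size sref = ≤-refl
SubF-size {b = and c d} (sandl q) = ≤-trans (SubF-size q) (m≤n⇒m≤1+n (m≤m+n (size c) (size d)))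
SubF-size {b = and c d} (sandr q) = ≤-trans (SubF-size q) (m≤n⇒m≤1+n (m≤n+m (size d) (size c)))
SubF-size {b = or c d} (sorl q) = ≤-trans (SubF-size q) (m≤n⇒m≤1+n (m≤m+n (size c) (size d)))
SubF-size {b = or c d} (sorr q) = ≤-trans (SubF-size q) (m≤n⇒m≤1+n (m≤n+m (size d) (size c)))
SubF-size (sdia q) = m≤n⇒m≤1+n (SubF-size q)
SubF-size (sbox q) = m≤n⇒m≤1+n (SubF-size q)
SubF-size (smu q) = m≤n⇒m≤1+n (SubF-size q)
SubF-size (snu q) = m≤n⇒m≤1+n (SubF-size q)

data OccNN (χ : Fm) : Fm → Set where
  oref : OccNN χ χ
  oandl : ∀ {a b} → OccNN χ a → OccNN χ (and a b)
  oandr : ∀ {a b} → OccNN χ b → OccNN χ (and a b)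
  oorl : ∀ {a b} → OccNN χ a → OccNN χ (or a b)
  oorr : ∀ {a b} → OccNN χ b → OccNN χ (or a b)
  odia : ∀ {x a} → OccNN χ a → OccNN χ (dia x a)
  obox : ∀ {x a} → OccNN χ a → OccNN χ (box x a)
  omu : ∀ {Y a} → OccNN χ a → OccNN χ (mu Y a)

OccNN-trans : ∀ {a b c} → OccNN a b → OccNN b c → OccNN a c
OccNN-trans p oref = p
OccNN-trans p (oandl q) = oandl (OccNN-trans p q)
OccNN-trans p (oandr q) = oandr (OccNN-trans p q)
OccNN-trans p (oorl q) = oorl (OccNN-trans p q)
OccNN-trans p (oorr q) = oorr (OccNN-trans p q)
OccNN-trans p (odia q) = odia (OccNN-trans p q)
OccNN-trans p (obox q) = obox (OccNN-trans p q)
OccNN-trans p (omu q) = omu (OccNN-trans p q)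

OccNN⇒SubF : ∀ {a b} → OccNN a b → SubF a b
OccNN⇒SubF oref = sref
OccNN⇒SubF (oandl q) = sandl (OccNN⇒SubF q)
OccNN⇒SubF (oandr q) = sandr (OccNN⇒SubF q)
OccNN⇒SubF (oorl q) = sorl (OccNN⇒SubF q)
OccNN⇒SubF (oorr q) = sorr (OccNN⇒SubF q)
OccNN⇒SubF (odia q) = sdia (OccNN⇒SubF q)
OccNN⇒SubF (obox q) = sbox (OccNN⇒SubF q)
OccNN⇒SubF (omu q) = smu (OccNN⇒SubF q)

OccNN⇒occNN : ∀ {χ φ} → OccNN χ φ → occNN χ φ ≡ true
OccNN⇒occNN {χ} oref = ∨-trueˡ _ (==-refl χ)
OccNN⇒occNN {χ} {and a b} (oandl q) = ∨-trueʳ (χ == and a b) (∨-trueˡ _ (OccNN⇒occNN q))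
OccNN⇒occNN {χ} {and a b} (oandr q) = ∨-trueʳ (χ == and a b) (∨-trueʳ (occNN χ a) (OccNN⇒occNN q))
OccNN⇒occNN {χ} {or a b} (oorl q) = ∨-trueʳ (χ == or a b) (∨-trueˡ _ (OccNN⇒occNN q))
OccNN⇒occNN {χ} {or a b} (oorr q) = ∨-trueʳ (χ == or a b) (∨-trueʳ (occNN χ a) (OccNN⇒occNN q))
OccNN⇒occNN {χ} {dia x a} (odia q) = ∨-trueʳ (χ == dia x a) (OccNN⇒occNN q)
OccNN⇒occNN {χ} {box x a} (obox q) = ∨-trueʳ (χ == box x a) (OccNN⇒occNN q)
OccNN⇒occNN {χ} {mu x a} (omu q) = ∨-trueʳ (χ == mu x a) (OccNN⇒occNN q)

occNN⇒OccNN : ∀ χ φ → occNN χ φ ≡ true → OccNN χ φ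
occNN⇒OccNN χ φ e with ∨-true {χ == φ} e
... | inj₁ χ==φ with ==⇒≡ χ φ χ==φ
...   | refl = oref
occNN⇒OccNN χ (and a b) e | inj₂ e′ = [ oandl ∘ occNN⇒OccNN χ a , oandr ∘ occNN⇒OccNN χ b ]′ (∨-true e′)
occNN⇒OccNN χ (or a b) e | inj₂ e′ = [ oorl ∘ occNN⇒OccNN χ a , oorr ∘ occNN⇒OccNN χ b ]′ (∨-true e′)
occNN⇒OccNN χ (dia x a) e | inj₂ e′ = odia (occNN⇒OccNN χ a e′)
occNN⇒OccNN χ (box x a) e | inj₂ e′ = obox (occNN⇒OccNN χ a e′)
occNN⇒OccNN χ (mu x a) e | inj₂ e′ = omu (occNN⇒OccNN χ a e′)

count-mono : ∀ p q xs → (∀ x → p x ≡ true → q x ≡ true) → count p xs ≤ count q xs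
count-mono p q [] _ = z≤n
count-mono p q (x ∷ xs) p⇒q with p x in px | q x in qx
... | true  | true  = s≤s (count-mono p q xs p⇒q)
... | true  | false with trans (sym (p⇒q x px)) qx
...   | ()
count-mono p q (x ∷ xs) p⇒q | false | true  = m≤n⇒m≤1+n (count-mono p q xs p⇒q)
count-mono p q (x ∷ xs) p⇒q | false | false = count-mono p q xs p⇒q

count-strict : ∀ p q xs {y} → (∀ x → p x ≡ true → q x ≡ true) → y ∈ xs → q y ≡ true → p y ≡ false
             → count p xs < count q xs
count-strict p q (x ∷ xs) p⇒q (here refl) qy py rewrite qy | py = s≤s (count-mono p q xs p⇒q)
count-strict p q (x ∷ xs) p⇒q (there m) qy py with p x in px | q x in qx
... | true  | true  = s≤s (count-strict p q xs p⇒q m qy py)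
... | true  | false with trans (sym (p⇒q x px)) qx
...   | ()
count-strict p q (x ∷ xs) p⇒q (there m) qy py | false | true  = m≤n⇒m≤1+n (count-strict p q xs p⇒q m qy py)
count-strict p q (x ∷ xs) p⇒q (there m) qy py | false | false = count-strict p q xs p⇒q m qy py

≤-max : ∀ (f : ℕ → ℕ) xs {y} → y ∈ xs → f y ≤ foldr _⊔_ 0 (map f xs)
≤-max f (x ∷ xs) (here refl) = m≤m⊔n (f x) _
≤-max f (x ∷ xs) (there m) = ≤-trans (≤-max f xs m) (m≤n⊔m (f x) _)

μbinder∈muVarsOf : ∀ {Y a} φ → SubF (mu Y a) φ → Y ∈ muVarsOf φ
μbinder∈muVarsOf (mu Z a) sref = here refl
μbinder∈muVarsOf (and a c) (sandl p) = ∈-++⁺ˡ (μbinder∈muVarsOf a p)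
μbinder∈muVarsOf (and a c) (sandr p) = ∈-++⁺ʳ (muVarsOf a) (μbinder∈muVarsOf c p)
μbinder∈muVarsOf (or a c) (sorl p) = ∈-++⁺ˡ (μbinder∈muVarsOf a p)
μbinder∈muVarsOf (or a c) (sorr p) = ∈-++⁺ʳ (muVarsOf a) (μbinder∈muVarsOf c p)
μbinder∈muVarsOf (dia x a) (sdia p) = μbinder∈muVarsOf a p
μbinder∈muVarsOf (box x a) (sbox p) = μbinder∈muVarsOf a p
μbinder∈muVarsOf (mu Z a) (smu p) = there (μbinder∈muVarsOf a p)
μbinder∈muVarsOf (nu Z a) (snu p) = μbinder∈muVarsOf a p

module Indices (ρ1 ρ0 : Fm) (clean : Clean ρ1 ρ0) where

  theta-correct : ∀ {Y b} → SubAny ρ1 ρ0 b → BinderOf Y b → theta ρ1 ρ0 Y ≡ just b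
  theta-correct (inj₁ p) bY rewrite findB-unique ρ1 (Unique-++⁻ˡ (boundVars ρ1) clean) p bY = refl
  theta-correct {Y} (inj₂ p) bY
    rewrite findB-unbound Y ρ1 (λ m → Unique-++-disjoint (boundVars ρ1) clean m (binder∈boundVars ρ0 p bY))
    = findB-unique ρ0 (Unique-++⁻ʳ (boundVars ρ1) clean) p bY

  SubAny-trans : ∀ {a b} → SubAny ρ1 ρ0 b → SubF a b → SubAny ρ1 ρ0 a
  SubAny-trans (inj₁ p) q = inj₁ (SubF-trans q p)
  SubAny-trans (inj₂ p) q = inj₂ (SubF-trans q p)

  geMu-binders : ∀ {V Y bV bY} → theta ρ1 ρ0 V ≡ just bV → theta ρ1 ρ0 Y ≡ just bY
               → geMu ρ1 ρ0 V Y ≡ occNN bY bV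
  geMu-binders {V} {Y} θV θY with theta ρ1 ρ0 V | theta ρ1 ρ0 Y
  geMu-binders refl refl | just _ | just _ = refl

  geMu⇒OccNN : ∀ V {Y bY} → theta ρ1 ρ0 Y ≡ just bY → geMu ρ1 ρ0 V Y ≡ true
             → ∃ λ bV → theta ρ1 ρ0 V ≡ just bV × OccNN bY bV
  geMu⇒OccNN V {Y} θY e with theta ρ1 ρ0 V | theta ρ1 ρ0 Y
  geMu⇒OccNN V refl e | just bV | just bY = bV , refl , occNN⇒OccNN bY bV e
  geMu⇒OccNN V θY () | nothing | _
  geMu⇒OccNN V () e | just _ | nothing

  muVars-binder : ∀ {Y a} → SubAny ρ1 ρ0 (mu Y a) → Y ∈ muVars ρ1 ρ0
  muVars-binder (inj₁ p) = ∈-++⁺ˡ (μbinder∈muVarsOf ρ1 p)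
  muVars-binder (inj₂ p) = ∈-++⁺ʳ (muVarsOf ρ1) (μbinder∈muVarsOf ρ0 p)

  idx-pos : ∀ {Y a} → SubAny ρ1 ρ0 (mu Y a) → 1 ≤ idx ρ1 ρ0 Y
  idx-pos {Y} {a} s = ≤-trans (s≤s z≤n) (count-strict (λ _ → false) (λ V → geMu ρ1 ρ0 V Y) (muVars ρ1 ρ0)
    (λ _ ()) (muVars-binder s) (trans (geMu-binders θY θY) (OccNN⇒occNN {mu Y a} oref)) refl)
    where θY = theta-correct s (bmu a)

  idx≤k : ∀ {Y a} → SubAny ρ1 ρ0 (mu Y a) → idx ρ1 ρ0 Y ≤ k ρ1 ρ0
  idx≤k s = ≤-max (idx ρ1 ρ0) (muVars ρ1 ρ0) (muVars-binder s)

  -- Every V ≥μ Y also satisfies V ≥μ Y′, while Y′ ≥μ Y fails because θ(Y′) is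
  -- a proper subformula of θ(Y); so Y′ has strictly more μ-variables above it.
  idx-< : ∀ {Y c Y′ c′} → SubAny ρ1 ρ0 (mu Y c) → OccNN (mu Y′ c′) c → idx ρ1 ρ0 Y < idx ρ1 ρ0 Y′
  idx-< {Y} {c} {Y′} {c′} sY q = count-strict (λ V → geMu ρ1 ρ0 V Y) (λ V → geMu ρ1 ρ0 V Y′) (muVars ρ1 ρ0)
    ≥Y⇒≥Y′ (muVars-binder sY′) (trans (geMu-binders θY′ θY′) (OccNN⇒occNN {mu Y′ c′} oref)) Y′≱Y
    where
    sY′ = SubAny-trans sY (smu (OccNN⇒SubF q))
    θY = theta-correct sY (bmu c)
    θY′ = theta-correct sY′ (bmu c′)
    ≥Y⇒≥Y′ : ∀ V → geMu ρ1 ρ0 V Y ≡ true → geMu ρ1 ρ0 V Y′ ≡ true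
    ≥Y⇒≥Y′ V e with geMu⇒OccNN V θY e
    ... | bV , θV , occ = trans (geMu-binders θV θY′) (OccNN⇒occNN (OccNN-trans (omu q) occ))
    Y′≱Y : geMu ρ1 ρ0 Y′ Y ≡ false
    Y′≱Y with geMu ρ1 ρ0 Y′ Y in e
    ... | false = refl
    ... | true with geMu⇒OccNN Y′ θY e
    ...   | bV , θY′′ , occ with trans (sym θY′) θY′′
    ...     | refl = ⊥-elim (<⇒≱ (s≤s (SubF-size (OccNN⇒SubF q))) (SubF-size (OccNN⇒SubF occ)))

  IdxBelow : Fm → ℕ → Set
  IdxBelow c Z = ∀ Y d → OccNN (mu Y d) c → idx ρ1 ρ0 Z < idx ρ1 ρ0 Y

-- Extensions and their Kleene approximants

⇒-true⁺ : ∀ {x y} → (x ≡ true → y ≡ true) → not x ∨ y ≡ true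
⇒-true⁺ {false} _ = refl
⇒-true⁺ {true} x⇒y = x⇒y refl

⇒-true⁻ : ∀ {x y} → not x ∨ y ≡ true → x ≡ true → y ≡ true
⇒-true⁻ y≡true refl = y≡true

all-true⁻ : ∀ {A : Set} (p : A → Bool) xs → all p xs ≡ true → ∀ {x} → x ∈ xs → p x ≡ true
all-true⁻ p (y ∷ xs) e (here refl) = proj₁ (∧-true e)
all-true⁻ p (y ∷ xs) e (there m) = all-true⁻ p xs (proj₂ (∧-true e)) m

all-true⁺ : ∀ {A : Set} (p : A → Bool) xs → (∀ {x} → x ∈ xs → p x ≡ true) → all p xs ≡ true
all-true⁺ p [] _ = refl
all-true⁺ p (y ∷ xs) h rewrite h (here refl) = all-true⁺ p xs (h ∘ there)

any-true⁻ : ∀ {A : Set} (p : A → Bool) xs → any p xs ≡ true → ∃ λ x → x ∈ xs × p x ≡ true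
any-true⁻ p (y ∷ xs) e with ∨-true {p y} e
... | inj₁ py = y , here refl , py
... | inj₂ e′ = let x , m , px = any-true⁻ p xs e′ in x , there m , px

any-true⁺ : ∀ {A : Set} (p : A → Bool) xs {x} → x ∈ xs → p x ≡ true → any p xs ≡ true
any-true⁺ p (y ∷ xs) (here refl) px = ∨-trueˡ _ px
any-true⁺ p (y ∷ xs) (there m) px = ∨-trueʳ (p y) (any-true⁺ p xs m px)

∈-allSubsets : ∀ n (S : Subset n) → S ∈ allSubsets n
∈-allSubsets zero [] = here refl
∈-allSubsets (suc n) (b ∷ S) = ∈-concatMap⁺ _ (Any.map (λ { refl → side b }) (∈-allSubsets n S))
  where
  side : ∀ b → b ∷ S ∈ (false ∷ S) ∷ (true ∷ S) ∷ []
  side false = here refl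
  side true = there (here refl)

∈-tabulate⁻ : ∀ {n} {f : Fin n → Bool} {w} → w ∈ₛ tabulate f → f w ≡ true
∈-tabulate⁻ {f = f} {w} w∈ = trans (sym (lookup∘tabulate f w)) ([]=⇒lookup w∈)

∈-tabulate⁺ : ∀ {n} {f : Fin n → Bool} {w} → f w ≡ true → w ∈ₛ tabulate f
∈-tabulate⁺ {f = f} {w} fw = lookup⇒[]= w _ (trans (lookup∘tabulate f w) fw)

¬⊂⇒⊇ : ∀ {n} {p q : Subset n} → p ⊆ q → ¬ p ⊂ q → q ⊆ p
¬⊂⇒⊇ {p = p} p⊆q ¬p⊂q {x} x∈q with x ∈ₛ? p
... | yes x∈p = x∈p
... | no x∉p = ⊥-elim (¬p⊂q (p⊆q , x , x∈q , x∉p))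

module Extension (M : Model) where
  open Model M

  e₀ : Env M
  e₀ _ = replicate n false

  ⊆ᵇ⇒⊆ : ∀ {S T : Subset n} → (_⊆ᵇ_ M S T) ≡ true → S ⊆ T
  ⊆ᵇ⇒⊆ e {w} w∈S = lookup⇒[]= w _ (⇒-true⁻ (all-true⁻ _ (allFin n) e (∈-allFin w)) ([]=⇒lookup w∈S))

  ⊆⇒⊆ᵇ : ∀ {S T : Subset n} → S ⊆ T → (_⊆ᵇ_ M S T) ≡ true
  ⊆⇒⊆ᵇ S⊆T = all-true⁺ _ (allFin n) λ {w} _ → ⇒-true⁺ λ w∈S → []=⇒lookup (S⊆T (lookup⇒[]= w _ w∈S))

  meets⇒ : ∀ {S T : Subset n} → meets M S T ≡ true → ∃ λ v → v ∈ₛ S × v ∈ₛ T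
  meets⇒ e with any-true⁻ _ (allFin n) e
  ... | v , _ , e′ = v , Prod.map (lookup⇒[]= v _) (lookup⇒[]= v _) (∧-true e′)

  ⇒meets : ∀ {S T : Subset n} {v} → v ∈ₛ S → v ∈ₛ T → meets M S T ≡ true
  ⇒meets {v = v} v∈S v∈T =
    any-true⁺ _ (allFin n) (∈-allFin v) (cong₂ _∧_ ([]=⇒lookup v∈S) ([]=⇒lookup v∈T))

  module _ (e : Env M) where

    and⁻ : ∀ a b {w} → w ∈ₛ semE M e (and a b) → w ∈ₛ semE M e a × w ∈ₛ semE M e b
    and⁻ a b = x∈p∩q⁻ (semE M e a) (semE M e b)

    or⁻ : ∀ a b {w} → w ∈ₛ semE M e (or a b) → w ∈ₛ semE M e a ⊎ w ∈ₛ semE M e b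
    or⁻ a b = x∈p∪q⁻ (semE M e a) (semE M e b)

    dia⁻ : ∀ x a {w} → w ∈ₛ semE M e (dia x a) → ∃ λ S → N x w S ≡ true × S ⊆ semE M e a
    dia⁻ x a w∈ with any-true⁻ _ (allSubsets n) (∈-tabulate⁻ w∈)
    ... | S , _ , e′ = S , proj₁ (∧-true e′) , ⊆ᵇ⇒⊆ (proj₂ (∧-true e′))

    dia⁺ : ∀ x a {w} S → N x w S ≡ true → S ⊆ semE M e a → w ∈ₛ semE M e (dia x a)
    dia⁺ x a {w} S nS S⊆ = ∈-tabulate⁺ (any-true⁺ _ (allSubsets n) (∈-allSubsets n S) (cong₂ _∧_ nS (⊆⇒⊆ᵇ S⊆)))

    box⁻ : ∀ x a {w} → w ∈ₛ semE M e (box x a) → ∀ S → N x w S ≡ true → ∃ λ v → v ∈ₛ S × v ∈ₛ semE M e a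
    box⁻ x a w∈ S nS = meets⇒ (⇒-true⁻ (all-true⁻ _ (allSubsets n) (∈-tabulate⁻ w∈) (∈-allSubsets n S)) nS)

    box⁺ : ∀ x a {w} → (∀ S → N x w S ≡ true → ∃ λ v → v ∈ₛ S × v ∈ₛ semE M e a) → w ∈ₛ semE M e (box x a)
    box⁺ x a h = ∈-tabulate⁺ (all-true⁺ _ (allSubsets n) λ {S} _ → ⇒-true⁺ λ nS →
      let v , v∈S , v∈a = h S nS in ⇒meets v∈S v∈a)

    mu⁻ : ∀ X a {w} → w ∈ₛ semE M e (mu X a) → ∀ S → semE M (upd M e X S) a ⊆ S → w ∈ₛ S
    mu⁻ X a {w} w∈ S pre =
      lookup⇒[]= w S (⇒-true⁻ (all-true⁻ _ (allSubsets n) (∈-tabulate⁻ w∈) (∈-allSubsets n S)) (⊆⇒⊆ᵇ pre))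

    mu⁺ : ∀ X a {w} → (∀ S → semE M (upd M e X S) a ⊆ S → w ∈ₛ S) → w ∈ₛ semE M e (mu X a)
    mu⁺ X a h = ∈-tabulate⁺ (all-true⁺ _ (allSubsets n) λ {S} _ → ⇒-true⁺ λ pre → []=⇒lookup (h S (⊆ᵇ⇒⊆ pre)))

    nu⁻ : ∀ X a {w} → w ∈ₛ semE M e (nu X a) → ∃ λ S → S ⊆ semE M (upd M e X S) a × w ∈ₛ S
    nu⁻ X a {w} w∈ with any-true⁻ _ (allSubsets n) (∈-tabulate⁻ w∈)
    ... | S , _ , e′ = S , ⊆ᵇ⇒⊆ (proj₁ (∧-true e′)) , lookup⇒[]= w S (proj₂ (∧-true e′))

    nu⁺ : ∀ X a {w} S → S ⊆ semE M (upd M e X S) a → w ∈ₛ S → w ∈ₛ semE M e (nu X a)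
    nu⁺ X a S post w∈S =
      ∈-tabulate⁺ (any-true⁺ _ (allSubsets n) (∈-allSubsets n S) (cong₂ _∧_ (⊆⇒⊆ᵇ post) ([]=⇒lookup w∈S)))

  upd-same : ∀ (e : Env M) X S → upd M e X S X ≡ S
  upd-same e X S rewrite ≡ᵇ-refl X = refl

  upd-other : ∀ (e : Env M) {X Z} S → Z ≢ X → upd M e X S Z ≡ e Z
  upd-other e S Z≢X rewrite ≢⇒≡ᵇ-false Z≢X = refl

  upd-⊆ : ∀ {e e′ : Env M} X S Z → (Z ≢ X → e Z ⊆ e′ Z) → upd M e X S Z ⊆ upd M e′ X S Z
  upd-⊆ X S Z h with Z ≡ᵇ X | ≡ᵇ-reflects Z X
  ... | true  | _        = ⊆-refl
  ... | false | ofⁿ Z≢X = h Z≢X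

  semE-mono : ∀ a {e e′ : Env M} → (∀ Z → FreeIn Z a → e Z ⊆ e′ Z) → semE M e a ⊆ semE M e′ a
  semE-mono ff h w∈ = w∈
  semE-mono tt h w∈ = w∈
  semE-mono (lit true p) h w∈ = w∈
  semE-mono (lit false p) h w∈ = w∈
  semE-mono (and a b) {e} h w∈ =
    x∈p∩q⁺ (Prod.map (semE-mono a (λ Z → h Z ∘ fandl)) (semE-mono b (λ Z → h Z ∘ fandr)) (and⁻ e a b w∈))
  semE-mono (or a b) {e} h w∈ =
    x∈p∪q⁺ (Sum.map (semE-mono a (λ Z → h Z ∘ forl)) (semE-mono b (λ Z → h Z ∘ forr)) (or⁻ e a b w∈))
  semE-mono (dia x a) {e} {e′} h w∈ =
    let S , nS , S⊆ = dia⁻ e x a w∈ in dia⁺ e′ x a S nS (semE-mono a (λ Z → h Z ∘ fdia) ∘ S⊆)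
  semE-mono (box x a) {e} {e′} h w∈ = box⁺ e′ x a λ S nS →
    let v , v∈S , v∈a = box⁻ e x a w∈ S nS in v , v∈S , semE-mono a (λ Z → h Z ∘ fbox) v∈a
  semE-mono (var Z) h w∈ = h Z fvar w∈
  semE-mono (mu X a) {e} {e′} h w∈ = mu⁺ e′ X a λ S pre →
    mu⁻ e X a w∈ S (⊆-trans (semE-mono a λ Z f → upd-⊆ {e} {e′} X S Z λ Z≢X → h Z (fmu (Z≢X ∘ sym) f)) pre)
  semE-mono (nu X a) {e} {e′} h w∈ =
    let S , post , w∈S = nu⁻ e X a w∈
    in nu⁺ e′ X a S (⊆-trans post (semE-mono a λ Z f → upd-⊆ {e} {e′} X S Z λ Z≢X → h Z (fnu (Z≢X ∘ sym) f))) w∈S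

  semE-cong : ∀ a {e e′ : Env M} → (∀ Z → FreeIn Z a → e Z ≡ e′ Z) → semE M e a ≡ semE M e′ a
  semE-cong a h = ⊆-antisym (semE-mono a λ Z f → ⊆-reflexive (h Z f)) (semE-mono a λ Z f → ⊆-reflexive (sym (h Z f)))

  closed-sem : ∀ t (e e′ : Env M) → Closed t → semE M e t ≡ semE M e′ t
  closed-sem t e e′ ct = semE-cong t λ Z f → ⊥-elim (ct Z f)

  mu-cong : ∀ {e e′ : Env M} X a b → (∀ S → semE M (upd M e X S) a ≡ semE M (upd M e′ X S) b)
          → semE M e (mu X a) ≡ semE M e′ (mu X b)
  mu-cong {e} {e′} X a b h = ⊆-antisym
    (λ w∈ → mu⁺ e′ X b λ S pre → mu⁻ e X a w∈ S (subst (_⊆ S) (sym (h S)) pre))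
    (λ w∈ → mu⁺ e X a λ S pre → mu⁻ e′ X b w∈ S (subst (_⊆ S) (h S) pre))

  nu-cong : ∀ {e e′ : Env M} X a b → (∀ S → semE M (upd M e X S) a ≡ semE M (upd M e′ X S) b)
          → semE M e (nu X a) ≡ semE M e′ (nu X b)
  nu-cong {e} {e′} X a b h = ⊆-antisym
    (λ w∈ → let S , post , w∈S = nu⁻ e X a w∈ in nu⁺ e′ X b S (subst (S ⊆_) (h S) post) w∈S)
    (λ w∈ → let S , post , w∈S = nu⁻ e′ X b w∈ in nu⁺ e X a S (subst (S ⊆_) (sym (h S)) post) w∈S)

  overlay : Env M → Subst → Env M
  overlay e s Z = maybe′ (sem M) (e Z) (s Z)

  overlay-∖ : ∀ (e : Env M) s Y S → overlay (upd M e Y S) (s ∖ Y) ≗ upd M (overlay e s) Y S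
  overlay-∖ e s Y S Z with Z ≡ᵇ Y
  ... | true  = refl
  ... | false = refl

  psub-sem : ∀ a s (e : Env M) → ClosedSubst s → semE M e (psub a s) ≡ semE M (overlay e s) a
  psub-sem ff s e cs = refl
  psub-sem tt s e cs = refl
  psub-sem (lit true p) s e cs = refl
  psub-sem (lit false p) s e cs = refl
  psub-sem (and a b) s e cs = cong₂ (zipWith _∧_) (psub-sem a s e cs) (psub-sem b s e cs)
  psub-sem (or a b) s e cs = cong₂ (zipWith _∨_) (psub-sem a s e cs) (psub-sem b s e cs)
  psub-sem (dia x a) s e cs =
    cong (λ T → tabulate λ w → any (λ S → N x w S ∧ (_⊆ᵇ_ M S T)) (allSubsets n)) (psub-sem a s e cs)
  psub-sem (box x a) s e cs =
    cong (λ T → tabulate λ w → all (λ S → not (N x w S) ∨ meets M S T) (allSubsets n)) (psub-sem a s e cs)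
  psub-sem (var Z) s e cs with s Z in sZ
  ... | just t  = closed-sem t e e₀ (cs Z t sZ)
  ... | nothing = refl
  psub-sem (mu Y a) s e cs = mu-cong Y (psub a (s ∖ Y)) a λ S →
    trans (psub-sem a (s ∖ Y) (upd M e Y S) (∖-closed Y cs)) (semE-cong a λ Z _ → overlay-∖ e s Y S Z)
  psub-sem (nu Y a) s e cs = nu-cong Y (psub a (s ∖ Y)) a λ S →
    trans (psub-sem a (s ∖ Y) (upd M e Y S) (∖-closed Y cs)) (semE-cong a λ Z _ → overlay-∖ e s Y S Z)

  module Approximants (e : Env M) (X : ℕ) (a : Fm) where

    step : Subset n → Subset n
    step S = semE M (upd M e X S) a

    approx : ℕ → Subset n
    approx zero = replicate n false
    approx (suc j) = step (approx j)

    step-mono : ∀ {S T} → S ⊆ T → step S ⊆ step T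
    step-mono {S} {T} S⊆T = semE-mono a λ Z _ → upd-⊆⁺ Z
      where
      upd-⊆⁺ : ∀ Z → upd M e X S Z ⊆ upd M e X T Z
      upd-⊆⁺ Z with Z ≡ᵇ X
      ... | true  = S⊆T
      ... | false = ⊆-refl

    approx⊆prefixed : ∀ j {S} → step S ⊆ S → approx j ⊆ S
    approx⊆prefixed zero _ = ⊥⊆
    approx⊆prefixed (suc j) pre = ⊆-trans (step-mono (approx⊆prefixed j pre)) pre

    approx⊆lfp : ∀ j → approx j ⊆ semE M e (mu X a)
    approx⊆lfp j w∈ = mu⁺ e X a λ S pre → approx⊆prefixed j pre w∈

    approx-ascending : ∀ j → approx j ⊆ approx (suc j)
    approx-ascending zero = ⊥⊆
    approx-ascending (suc j) = step-mono (approx-ascending j)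

    approx-grows-or-stops : ∀ j → j ≤ ∣ approx j ∣ ⊎ step (approx j) ⊆ approx j
    approx-grows-or-stops zero = inj₁ z≤n
    approx-grows-or-stops (suc j) with approx-grows-or-stops j
    ... | inj₂ stops = inj₂ (step-mono stops)
    ... | inj₁ grows with approx j ⊂? approx (suc j)
    ...   | yes ⊂ = inj₁ (≤-trans (s≤s grows) (p⊂q⇒∣p∣<∣q∣ ⊂))
    ...   | no ¬⊂ = inj₂ (step-mono (¬⊂⇒⊇ (approx-ascending j) ¬⊂))

    approx-prefixed : step (approx n) ⊆ approx n
    approx-prefixed with approx-grows-or-stops n
    ... | inj₂ stops = stops
    ... | inj₁ grows = subst (step (approx n) ⊆_) (sym (∣p∣≡n⇒p≡⊤ (≤-antisym (∣p∣≤n (approx n)) grows))) ⊆⊤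

    lfp⊆approx : semE M e (mu X a) ⊆ approx n
    lfp⊆approx w∈ = mu⁻ e X a w∈ (approx n) approx-prefixed

module Timeouts (M : Model) where
  open Model M

  getT-zero : ∀ {l} (m : Vec ℕ l) → getT M m 0 ≡ 0
  getT-zero [] = refl
  getT-zero (_ ∷ _) = refl

  Agree< : ℕ → ∀ {l} → Vec ℕ l → Vec ℕ l → Set
  Agree< d m m′ = ∀ i → i < d → getT M m i ≡ getT M m′ i

  getT-replicate : ∀ l x i → 1 ≤ i → i ≤ l → getT M (replicate l x) i ≡ x
  getT-replicate (suc l) x (suc zero) _ _ = refl
  getT-replicate (suc l) x (suc (suc i)) _ (s≤s i≤l) = getT-replicate l x (suc i) (s≤s z≤n) i≤l

  getT-at-same : ∀ {l} (m : Vec ℕ l) i → getT M (atT M m i) i ≡ getT M m i ∸ 1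
  getT-at-same [] i = refl
  getT-at-same (x ∷ m) zero = refl
  getT-at-same (x ∷ m) (suc zero) = refl
  getT-at-same (x ∷ m) (suc (suc i)) = getT-at-same m (suc i)

  getT-at-above : ∀ {l} (m : Vec ℕ l) i i′ → 1 ≤ i → i < i′ → i′ ≤ l → getT M (atT M m i) i′ ≡ n
  getT-at-above (x ∷ m) (suc zero) (suc (suc i′)) _ _ (s≤s i′≤l) = getT-replicate _ n (suc i′) (s≤s z≤n) i′≤l
  getT-at-above (x ∷ m) (suc zero) (suc zero) _ (s≤s ()) _
  getT-at-above (x ∷ m) (suc (suc i)) (suc (suc i′)) _ (s≤s i<i′) (s≤s i′≤l) =
    getT-at-above m (suc i) (suc i′) (s≤s z≤n) i<i′ i′≤l

  getT-at-below : ∀ {l} (m : Vec ℕ l) i i′ → i′ < i → getT M (atT M m i) i′ ≡ getT M m i′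
  getT-at-below [] i i′ _ = refl
  getT-at-below (x ∷ m) (suc zero) zero _ = refl
  getT-at-below (x ∷ m) (suc (suc i)) zero _ = refl
  getT-at-below (x ∷ m) (suc zero) (suc i′) (s≤s ())
  getT-at-below (x ∷ m) (suc (suc i)) (suc zero) _ = refl
  getT-at-below (x ∷ m) (suc (suc i)) (suc (suc i′)) (s≤s i′<i) = getT-at-below m (suc i) (suc i′) i′<i

  atT-agree : ∀ {l} d (m m′ : Vec ℕ l) → 1 ≤ d → Agree< (suc d) m m′ → atT M m d ≡ atT M m′ d
  atT-agree d [] [] _ _ = refl
  atT-agree (suc zero) (x ∷ m) (y ∷ m′) _ ag = cong (λ z → (z ∸ 1) ∷ replicate _ n) (ag 1 ≤-refl)
  atT-agree (suc (suc d)) (x ∷ m) (y ∷ m′) _ ag =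
    cong₂ _∷_ (ag 1 (s≤s (s≤s z≤n))) (atT-agree (suc d) m m′ (s≤s z≤n) ag′)
    where
    ag′ : Agree< (suc (suc d)) m m′
    ag′ zero _ = trans (getT-zero m) (sym (getT-zero m′))
    ag′ (suc i) i<d = ag (suc (suc i)) (s≤s i<d)

  agree-positive : ∀ i {l} {m m′ : Vec ℕ l} {j} → Agree< (suc i) m m′ → getT M m i ≡ suc j
                 → getT M m′ i ≡ suc j × atT M m i ≡ atT M m′ i
  agree-positive zero {m = m} ag m≡ = ⊥-elim (0≢1+n (trans (sym (getT-zero m)) m≡))
  agree-positive (suc i) {m = m} {m′} ag m≡ = trans (sym (ag (suc i) ≤-refl)) m≡ , atT-agree (suc i) m m′ (s≤s z≤n) ag

  TSem-mu-agree : ∀ ρ1 ρ0 {m m′ : Vec ℕ (k ρ1 ρ0)} {Z d w} → Agree< (suc (idx ρ1 ρ0 Z)) m m′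
                → TSem M ρ1 ρ0 m (mu Z d) w → TSem M ρ1 ρ0 m′ (mu Z d) w
  TSem-mu-agree ρ1 ρ0 ag (t-nd ¬dfr w∈) = t-nd ¬dfr w∈
  TSem-mu-agree ρ1 ρ0 {Z = Z} ag (t-mu dfr m≡ t) =
    let m′≡ , at≡ = agree-positive (idx ρ1 ρ0 Z) ag m≡
    in t-mu dfr m′≡ (subst (λ v → TSem M ρ1 ρ0 v _ _) at≡ t)

data Head : Set where
  atomic and-h or-h : Head
  dia-h box-h mu-h nu-h : ℕ → Head

head : Fm → Head
head (and a b) = and-h
head (or a b) = or-h
head (dia x a) = dia-h x
head (box x a) = box-h x
head (mu Y a) = mu-h Y
head (nu Y a) = nu-h Y
head _ = atomic

head-sub : ∀ χ b X → head χ ≢ atomic → head (sub χ b X) ≡ head χ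
head-sub (and a c) b X _ = refl
head-sub (or a c) b X _ = refl
head-sub (dia x a) b X _ = refl
head-sub (box x a) b X _ = refl
head-sub (mu Y a) b X _ with Y ≡ᵇ X
... | true  = refl
... | false = refl
head-sub (nu Y a) b X _ with Y ≡ᵇ X
... | true  = refl
... | false = refl
head-sub ff b X ¬atomic = ⊥-elim (¬atomic refl)
head-sub tt b X ¬atomic = ⊥-elim (¬atomic refl)
head-sub (lit c p) b X ¬atomic = ⊥-elim (¬atomic refl)
head-sub (var Z) b X ¬atomic = ⊥-elim (¬atomic refl)

binder-head : ∀ {X b} → BinderOf X b → head b ≢ atomic
binder-head (bmu a) ()
binder-head (bnu a) ()

head-nu : ∀ χ {Y} → head χ ≡ nu-h Y → ∃ λ a → χ ≡ nu Y a
head-nu (nu Y a) refl = a , refl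

module NonDeferrals (ρ1 ρ0 : Fm) (clean : Clean ρ1 ρ0) (irr : Irredundant ρ1 ρ0) (alt : AltFree ρ1 ρ0) where
  open DeferralDecision ρ1 ρ0 using (theta-binder)
  open Indices ρ1 ρ0 clean using (theta-correct; SubAny-trans)

  Clf-head : ∀ {χ φ} → head χ ≢ atomic → Clf ρ1 ρ0 χ φ → head φ ≡ head χ
  Clf-head _ (clf-done _) = refl
  Clf-head {χ} ¬atomic (clf-step {X = X} {b} _ _ _ c) =
    trans (Clf-head (¬atomic ∘ trans (sym (head-sub χ b X ¬atomic))) c) (head-sub χ b X ¬atomic)

  Clf-head-free : ∀ {χ φ X} → Clf ρ1 ρ0 χ φ → FreeIn X χ
                → (head χ ≢ atomic × head φ ≡ head χ) ⊎ (∃ λ b → theta ρ1 ρ0 X ≡ just b × head φ ≡ head b)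
  Clf-head-free (clf-done cl) f = ⊥-elim (cl _ f)
  Clf-head-free {var Z} (clf-step fvar θZ _ c) fvar rewrite ≡ᵇ-refl Z =
    inj₂ (_ , θZ , Clf-head (binder-head (theta-binder Z θZ)) c)
  Clf-head-free {and a b} c _ = inj₁ ((λ ()) , Clf-head (λ ()) c)
  Clf-head-free {or a b} c _ = inj₁ ((λ ()) , Clf-head (λ ()) c)
  Clf-head-free {dia x a} c _ = inj₁ ((λ ()) , Clf-head (λ ()) c)
  Clf-head-free {box x a} c _ = inj₁ ((λ ()) , Clf-head (λ ()) c)
  Clf-head-free {mu Y a} c _ = inj₁ ((λ ()) , Clf-head (λ ()) c)
  Clf-head-free {nu Y a} c _ = inj₁ ((λ ()) , Clf-head (λ ()) c)

  atomic-non-deferral : ∀ φ → head φ ≡ atomic → ¬ Dfr ρ1 ρ0 φ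
  atomic-non-deferral φ φ-atomic (_ , χ , _ , (X , fX , _) , c) with Clf-head-free c fX
  ... | inj₁ (¬atomic , φ≡χ) = ¬atomic (trans (sym φ≡χ) φ-atomic)
  ... | inj₂ (b , θX , φ≡b) = binder-head (theta-binder X θX) (trans (sym φ≡b) φ-atomic)

  -- A deferral headed by ν must be the closure of νY.c itself; its body c would then have
  -- a free μ-variable and, by irredundancy, the free ν-variable Y.
  nu-non-deferral : ∀ {Y c s} → SubAny ρ1 ρ0 (nu Y c) → ClosedSubst s → ¬ Dfr ρ1 ρ0 (nu Y (psub c (s ∖ Y)))
  nu-non-deferral {Y} {c} {s} sc cs (icl , χ , sχ , (X , fX , μX) , clf) with Clf-head-free clf fX
  ... | inj₂ (b , θX , φ≡b) with trans (sym θX) (proj₂ μX)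
  ...   | refl with φ≡b
  ...     | ()
  nu-non-deferral {Y} {c} {s} sc cs (icl , χ , sχ , (X , fX , μX) , clf) | inj₁ (_ , φ≡χ) with head-nu χ (sym φ≡χ)
  ... | a , refl with trans (sym (theta-correct sχ (bnu a))) (theta-correct sc (bnu c))
  ...   | refl with fX
  ...     | fnu _ fX′ = alt c (SubAny-trans sc (snu sref)) X Y fX′ fY μX (c , theta-correct sc (bnu c))
    where
    fY : FreeIn Y c
    fY = proj₁ (free-psub c Y (∖-closed Y cs) (proj₂ (irr Y (psub c (s ∖ Y))) icl))

data Immediate : Fm → Fm → Set where
  iandl : ∀ {a b} → Immediate a (and a b)
  iandr : ∀ {a b} → Immediate b (and a b)
  iorl : ∀ {a b} → Immediate a (or a b)
  iorr : ∀ {a b} → Immediate b (or a b)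
  idia : ∀ {x a} → Immediate a (dia x a)
  ibox : ∀ {x a} → Immediate a (box x a)

Immediate-SubF : ∀ {a φ} → Immediate a φ → SubF a φ
Immediate-SubF iandl = sandl sref
Immediate-SubF iandr = sandr sref
Immediate-SubF iorl = sorl sref
Immediate-SubF iorr = sorr sref
Immediate-SubF idia = sdia sref
Immediate-SubF ibox = sbox sref

Immediate-OccNN : ∀ {a φ q} → Immediate a φ → OccNN q a → OccNN q φ
Immediate-OccNN iandl = oandl
Immediate-OccNN iandr = oandr
Immediate-OccNN iorl = oorl
Immediate-OccNN iorr = oorr
Immediate-OccNN idia = odia
Immediate-OccNN ibox = obox

Immediate-FreeIn : ∀ {a φ Z} → Immediate a φ → FreeIn Z a → FreeIn Z φ
Immediate-FreeIn iandl = fandl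
Immediate-FreeIn iandr = fandr
Immediate-FreeIn iorl = forl
Immediate-FreeIn iorr = forr
Immediate-FreeIn idia = fdia
Immediate-FreeIn ibox = fbox

Immediate-InCl : ∀ {ρ a φ} → Immediate a φ → InCl ρ φ → InCl ρ a
Immediate-InCl iandl = candl
Immediate-InCl iandr = candr
Immediate-InCl iorl = corl
Immediate-InCl iorr = corr
Immediate-InCl idia = cdia
Immediate-InCl ibox = cbox

InCL-immediate : ∀ {ρ1 ρ0 a φ} → Immediate a φ → InCL ρ1 ρ0 φ → InCL ρ1 ρ0 a
InCL-immediate i = Sum.map (Immediate-InCl i) (Immediate-InCl i)

InCL-unfold-mu : ∀ {ρ1 ρ0 X a} → InCL ρ1 ρ0 (mu X a) → InCL ρ1 ρ0 (sub a (mu X a) X)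
InCL-unfold-mu = Sum.map cmu cmu

psub-bound : ∀ s {Z t} → s Z ≡ just t → psub (var Z) s ≡ t
psub-bound s sZ rewrite sZ = refl

-- Closure formulae as instances of subformulae

Immediate-binder : ∀ {a b Z} → BinderOf Z b → ¬ Immediate a b
Immediate-binder (bmu _) ()
Immediate-binder (bnu _) ()

module Instances (ρ1 ρ0 : Fm) (clean : Clean ρ1 ρ0) (irr : Irredundant ρ1 ρ0) (alt : AltFree ρ1 ρ0) where
  open Indices ρ1 ρ0 clean
  open NonDeferrals ρ1 ρ0 clean irr alt using (nu-non-deferral)

  mutual
    data Instance : Fm → Set where
      inst : ∀ {ψ} c s → ψ ≡ psub c s → SubAny ρ1 ρ0 c → ClosedSubst s
          → (∀ Z → FreeIn Z c → Binding c s Z) → Instance ψ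

    data Binding (c : Fm) (s : Subst) (Z : ℕ) : Set where
      μ-bound : ∀ d → s Z ≡ just (mu Z d) → Instance (mu Z d) → InCL ρ1 ρ0 (mu Z d) → IdxBelow c Z → IsMu ρ1 ρ0 Z
              → Binding c s Z
      ν-bound : ∀ d → s Z ≡ just (nu Z d) → Instance (nu Z d) → InCL ρ1 ρ0 (nu Z d) → Binding c s Z

  Binding-value : ∀ {c s Z} → Binding c s Z → ∃ λ t → s Z ≡ just t
  Binding-value (μ-bound d sZ _ _ _ _) = mu _ d , sZ
  Binding-value (ν-bound d sZ _ _) = nu _ d , sZ

  Binding-immediate : ∀ {c₁ c s Z} → Immediate c₁ c → Binding c s Z → Binding c₁ s Z
  Binding-immediate i (μ-bound d sZ r icl below μZ) = μ-bound d sZ r icl (λ Y d → below Y d ∘ Immediate-OccNN i) μZ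
  Binding-immediate i (ν-bound d sZ r icl) = ν-bound d sZ r icl

  Instance-child : ∀ {c₁ c} s → Immediate c₁ c → SubAny ρ1 ρ0 c → ClosedSubst s
                 → (∀ Z → FreeIn Z c → Binding c s Z) → Instance (psub c₁ s)
  Instance-child {c₁} s i sc cs bs =
    inst c₁ s refl (SubAny-trans sc (Immediate-SubF i)) cs (λ Z → Binding-immediate i ∘ bs Z ∘ Immediate-FreeIn i)

  Instance-immediate : ∀ {a ψ} → Instance ψ → Immediate a ψ → Instance a
  Instance-immediate {a} (inst (var Z) s ψ≡ _ _ bs) i with bs Z fvar
  ... | μ-bound d sZ _ _ _ _ = ⊥-elim (Immediate-binder (bmu d) (subst (Immediate a) (trans ψ≡ (psub-bound s sZ)) i))
  ... | ν-bound d sZ _ _ = ⊥-elim (Immediate-binder (bnu d) (subst (Immediate a) (trans ψ≡ (psub-bound s sZ)) i))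
  Instance-immediate (inst (and c₁ c₂) s refl sc cs bs) iandl = Instance-child s iandl sc cs bs
  Instance-immediate (inst (and c₁ c₂) s refl sc cs bs) iandr = Instance-child s iandr sc cs bs
  Instance-immediate (inst (or c₁ c₂) s refl sc cs bs) iorl = Instance-child s iorl sc cs bs
  Instance-immediate (inst (or c₁ c₂) s refl sc cs bs) iorr = Instance-child s iorr sc cs bs
  Instance-immediate (inst (dia x c₁) s refl sc cs bs) idia = Instance-child s idia sc cs bs
  Instance-immediate (inst (box x c₁) s refl sc cs bs) ibox = Instance-child s ibox sc cs bs
  Instance-immediate (inst ff s refl _ _ _) ()
  Instance-immediate (inst tt s refl _ _ _) ()
  Instance-immediate (inst (lit _ _) s refl _ _ _) ()
  Instance-immediate (inst (mu _ _) s refl _ _ _) ()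
  Instance-immediate (inst (nu _ _) s refl _ _ _) ()

  Instance-unfold-mu : ∀ {X a} → InCL ρ1 ρ0 (mu X a) → Instance (mu X a) → Instance (sub a (mu X a) X)
  Instance-unfold-mu icl (inst (var Z) s ψ≡ _ _ bs) with bs Z fvar
  ... | μ-bound d sZ r icl′ _ _ with trans ψ≡ (psub-bound s sZ)
  ...   | refl = Instance-unfold-mu icl′ r
  Instance-unfold-mu icl (inst (var Z) s ψ≡ _ _ bs) | ν-bound d sZ _ _ with trans ψ≡ (psub-bound s sZ)
  ...   | ()
  Instance-unfold-mu {X} icl r@(inst (mu X c) s refl sc cs bs) =
    inst c s′ (sub-psub c X (mu X a) (∖-closed X cs) (∖-same s X)) (SubAny-trans sc (smu sref))
        (↦-closed X mu-closed (∖-closed X cs)) bindings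
    where
    a = psub c (s ∖ X)
    s′ = (s ∖ X) [ X ↦ mu X a ]
    mu-closed : Closed (mu X a)
    mu-closed = psub-closed (mu X c) cs λ Z f → Binding-value (bs Z f)
    bindings : ∀ Z → FreeIn Z c → Binding c s′ Z
    bindings Z f with Z ≟ X
    ... | yes refl = μ-bound a (↦-same (s ∖ X) X (mu X a)) r icl (λ _ _ → idx-< sc) (c , theta-correct sc (bmu c))
    ... | no Z≢X with bs Z (fmu (Z≢X ∘ sym) f)
    ...   | μ-bound d sZ r′ icl′ below μZ =
            μ-bound d (trans (∖↦-other s (mu X a) Z≢X) sZ) r′ icl′
                    (λ Y d → below Y d ∘ omu) μZ
    ...   | ν-bound d sZ r′ icl′ = ν-bound d (trans (∖↦-other s (mu X a) Z≢X) sZ) r′ icl′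

  Instance-unfold-nu : ∀ {X a} → InCL ρ1 ρ0 (nu X a) → Instance (nu X a) → Instance (sub a (nu X a) X)
  Instance-unfold-nu icl (inst (var Z) s ψ≡ _ _ bs) with bs Z fvar
  ... | ν-bound d sZ r icl′ with trans ψ≡ (psub-bound s sZ)
  ...   | refl = Instance-unfold-nu icl′ r
  Instance-unfold-nu icl (inst (var Z) s ψ≡ _ _ bs) | μ-bound d sZ _ _ _ _ with trans ψ≡ (psub-bound s sZ)
  ...   | ()
  Instance-unfold-nu {X} icl r@(inst (nu X c) s refl sc cs bs) =
    inst c s′ (sub-psub c X (nu X a) (∖-closed X cs) (∖-same s X)) (SubAny-trans sc (snu sref))
        (↦-closed X nu-closed (∖-closed X cs)) bindings
    where
    a = psub c (s ∖ X)
    s′ = (s ∖ X) [ X ↦ nu X a ]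
    nu-closed : Closed (nu X a)
    nu-closed = psub-closed (nu X c) cs λ Z f → Binding-value (bs Z f)
    X-free : FreeIn X c
    X-free = proj₁ (free-psub c X (∖-closed X cs) (proj₂ (irr X a) icl))
    bindings : ∀ Z → FreeIn Z c → Binding c s′ Z
    bindings Z f with Z ≟ X
    ... | yes refl = ν-bound a (↦-same (s ∖ X) X (nu X a)) r icl
    ... | no Z≢X with bs Z (fnu (Z≢X ∘ sym) f)
    ...   | μ-bound _ _ _ _ _ μZ = ⊥-elim (alt c (SubAny-trans sc (snu sref)) Z X f X-free μZ (c , theta-correct sc (bnu c)))
    ...   | ν-bound d sZ r′ icl′ = ν-bound d (trans (∖↦-other s (nu X a) Z≢X) sZ) r′ icl′

  Instance-nu-non-deferral : ∀ {Y a} → Instance (nu Y a) → ¬ Dfr ρ1 ρ0 (nu Y a)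
  Instance-nu-non-deferral (inst (var Z) s ψ≡ _ _ bs) with bs Z fvar
  ... | ν-bound d sZ r _ with trans ψ≡ (psub-bound s sZ)
  ...   | refl = Instance-nu-non-deferral r
  Instance-nu-non-deferral (inst (var Z) s ψ≡ _ _ bs) | μ-bound d sZ _ _ _ _ with trans ψ≡ (psub-bound s sZ)
  ...   | ()
  Instance-nu-non-deferral (inst (nu Y c) s refl sc cs _) = nu-non-deferral sc cs

  Instance-InCl : ∀ {ρ ψ} → (∀ {φ} → InCl ρ φ → InCL ρ1 ρ0 φ) → Instance ρ → InCl ρ ψ → Instance ψ
  Instance-InCl emb r croot = r
  Instance-InCl emb r (candl p) = Instance-immediate (Instance-InCl emb r p) iandl
  Instance-InCl emb r (candr p) = Instance-immediate (Instance-InCl emb r p) iandr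
  Instance-InCl emb r (corl p) = Instance-immediate (Instance-InCl emb r p) iorl
  Instance-InCl emb r (corr p) = Instance-immediate (Instance-InCl emb r p) iorr
  Instance-InCl emb r (cdia p) = Instance-immediate (Instance-InCl emb r p) idia
  Instance-InCl emb r (cbox p) = Instance-immediate (Instance-InCl emb r p) ibox
  Instance-InCl emb r (cmu p) = Instance-unfold-mu (emb p) (Instance-InCl emb r p)
  Instance-InCl emb r (cnu p) = Instance-unfold-nu (emb p) (Instance-InCl emb r p)

  Instance-root : ∀ {ρ} → Closed ρ → SubAny ρ1 ρ0 ρ → Instance ρ
  Instance-root {ρ} cl sc = inst ρ ∅ (sym (psub-∅ ρ)) sc (λ _ _ ()) (λ Z f → ⊥-elim (cl Z f))

  Instance-closure : Closed ρ1 → Closed ρ0 → ∀ {ψ} → InCL ρ1 ρ0 ψ → Instance ψ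
  Instance-closure cl1 cl0 (inj₁ p) = Instance-InCl inj₁ (Instance-root cl1 (inj₁ sref)) p
  Instance-closure cl1 cl0 (inj₂ p) = Instance-InCl inj₂ (Instance-root cl0 (inj₂ sref)) p

-- Soundness of the timed extension

module Soundness (M : Model) (ρ1 ρ0 : Fm) (clean : Clean ρ1 ρ0) (irr : Irredundant ρ1 ρ0) (alt : AltFree ρ1 ρ0) where
  open Model M
  open Extension M
  open Timeouts M
  open DeferralDecision ρ1 ρ0 using (dfr?)
  open Indices ρ1 ρ0 clean
  open NonDeferrals ρ1 ρ0 clean irr alt
  open Instances ρ1 ρ0 clean irr alt

  Timeout : Set
  Timeout = Vec ℕ (k ρ1 ρ0)

  _⊆⟦_⟧_ : Subset n → Timeout → Fm → Set
  S ⊆⟦ m ⟧ φ = ∀ {w} → w ∈ₛ S → TSem M ρ1 ρ0 m φ w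

  Fresh : Fm → Timeout → Set
  Fresh c m = ∀ Y d → OccNN (mu Y d) c → getT M m (idx ρ1 ρ0 Y) ≡ n

  data Kind (c : Fm) (e : Env M) (m : Timeout) (Z : ℕ) : Fm → Set where
    μ-kind : ∀ {d} → IdxBelow c Z → e Z ⊆⟦ m ⟧ mu Z d → Kind c e m Z (mu Z d)
    ν-kind : ∀ {t} → ¬ Dfr ρ1 ρ0 t → Kind c e m Z t

  record Entry (c : Fm) (s : Subst) (e : Env M) (m : Timeout) (Z : ℕ) : Set where
    constructor entry
    field
      term : Fm
      bound : s Z ≡ just term
      approximates : e Z ⊆ sem M term
      kind : Kind c e m Z term

  record Invariant (c : Fm) (s : Subst) (e : Env M) (m : Timeout) : Set where
    field
      subformula : SubAny ρ1 ρ0 c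
      closed : ClosedSubst s
      entries : ∀ Z → FreeIn Z c → Entry c s e m Z
      fresh : Fresh c m
  open Invariant

  Invariant-immediate : ∀ {c₁ c s e m} → Immediate c₁ c → Invariant c s e m → Invariant c₁ s e m
  Invariant-immediate {c₁} {c} {s} {e} {m} i inv = record
    { subformula = SubAny-trans (subformula inv) (Immediate-SubF i)
    ; closed = closed inv
    ; entries = λ Z f → weaken (entries inv Z (Immediate-FreeIn i f))
    ; fresh = λ Y d → fresh inv Y d ∘ Immediate-OccNN i
    }
    where
    weaken : ∀ {Z} → Entry c s e m Z → Entry c₁ s e m Z
    weaken (entry t sZ sound (μ-kind below t⊆)) = entry t sZ sound (μ-kind (λ Y d → below Y d ∘ Immediate-OccNN i) t⊆)
    weaken (entry t sZ sound (ν-kind ¬dfr)) = entry t sZ sound (ν-kind ¬dfr)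

  approximation : ∀ {c s e m} → Invariant c s e m → semE M e c ⊆ sem M (psub c s)
  approximation {c} {s} {e} inv =
    ⊆-trans (semE-mono c entry-bound) (⊆-reflexive (sym (psub-sem c s e₀ (closed inv))))
    where
    entry-bound : ∀ Z → FreeIn Z c → e Z ⊆ overlay e₀ s Z
    entry-bound Z f with entries inv Z f
    ... | entry t sZ e⊆t _ rewrite sZ = e⊆t

  by-deferral : ∀ {c s e m} → Invariant c s e m → InCL ρ1 ρ0 (psub c s)
              → (Dfr ρ1 ρ0 (psub c s) → semE M e c ⊆⟦ m ⟧ psub c s) → semE M e c ⊆⟦ m ⟧ psub c s
  by-deferral inv icl timed-dfr with dfr? _ icl
  ... | yes dfr = timed-dfr dfr
  ... | no ¬dfr = λ w∈ → t-nd ¬dfr ([]=⇒lookup (approximation inv w∈))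

  var-timed : ∀ {Z s e m} → Entry (var Z) s e m Z → e Z ⊆⟦ m ⟧ psub (var Z) s
  var-timed (entry t sZ _ (μ-kind _ e⊆t)) w∈ rewrite sZ = e⊆t w∈
  var-timed (entry t sZ e⊆t (ν-kind ¬dfr)) w∈ rewrite sZ = t-nd ¬dfr ([]=⇒lookup (e⊆t w∈))

  mutual
    timed : ∀ c {s e m} → Invariant c s e m → InCL ρ1 ρ0 (psub c s) → semE M e c ⊆⟦ m ⟧ psub c s
    timed (var Z) inv _ = var-timed (entries inv Z fvar)
    timed ff inv icl = by-deferral inv icl λ _ w∈ → ⊥-elim (∉⊥ w∈)
    timed tt inv icl = by-deferral inv icl λ dfr → ⊥-elim (atomic-non-deferral tt refl dfr)
    timed (lit b p) inv icl = by-deferral inv icl λ dfr → ⊥-elim (atomic-non-deferral (lit b p) refl dfr)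
    timed (nu Y c) inv icl = by-deferral inv icl λ dfr → ⊥-elim (nu-non-deferral (subformula inv) (closed inv) dfr)
    timed (and a b) {e = e} inv icl = by-deferral inv icl λ dfr w∈ →
      let w∈a , w∈b = and⁻ e a b w∈
      in t-and dfr (timed a (Invariant-immediate iandl inv) (InCL-immediate iandl icl) w∈a)
                   (timed b (Invariant-immediate iandr inv) (InCL-immediate iandr icl) w∈b)
    timed (or a b) {e = e} inv icl = by-deferral inv icl λ dfr w∈ →
      [ t-orl dfr ∘ timed a (Invariant-immediate iorl inv) (InCL-immediate iorl icl)
      , t-orr dfr ∘ timed b (Invariant-immediate iorr inv) (InCL-immediate iorr icl) ]′ (or⁻ e a b w∈)
    timed (dia x a) {e = e} inv icl = by-deferral inv icl λ dfr w∈ →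
      let S , nS , S⊆a = dia⁻ e x a w∈
      in t-dia dfr S nS λ v v∈S →
           timed a (Invariant-immediate idia inv) (InCL-immediate idia icl) (S⊆a (lookup⇒[]= v S v∈S))
    timed (box x a) {e = e} inv icl = by-deferral inv icl λ dfr w∈ → t-box dfr λ S nS →
      let v , v∈S , v∈a = box⁻ e x a w∈ S nS
      in v , []=⇒lookup v∈S , timed a (Invariant-immediate ibox inv) (InCL-immediate ibox icl) v∈a
    timed (mu Y c) {e = e} {m} inv icl = by-deferral inv icl λ dfr w∈ →
      timed-approx Y c inv icl dfr n m (fresh inv Y c oref) (λ _ _ → refl) (lfp⊆approx w∈)
      where open Approximants e Y c

    timed-approx : ∀ Y c {s e m} → Invariant (mu Y c) s e m → InCL ρ1 ρ0 (psub (mu Y c) s) → Dfr ρ1 ρ0 (psub (mu Y c) s)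
                 → ∀ j m′ → getT M m′ (idx ρ1 ρ0 Y) ≡ j → Agree< (idx ρ1 ρ0 Y) m m′
                 → Approximants.approx e Y c j ⊆⟦ m′ ⟧ psub (mu Y c) s
    timed-approx Y c inv icl dfr zero m′ _ _ w∈ = ⊥-elim (∉⊥ w∈)
    timed-approx Y c {s} {e} {m} inv icl dfr (suc j) m′ m′≡ ag w∈ =
      t-mu dfr m′≡ (subst (λ φ → TSem M ρ1 ρ0 m″ φ _) (sym unfold≡) (timed c inv′ icl′ w∈))
      where
      open Approximants e Y c
      sc = subformula inv
      iY = idx ρ1 ρ0 Y
      a = psub c (s ∖ Y)
      s′ = (s ∖ Y) [ Y ↦ mu Y a ]
      e′ = upd M e Y (approx j)
      m″ = atT M m′ iY

      unfold≡ : sub a (mu Y a) Y ≡ psub c s′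
      unfold≡ = sub-psub c Y (mu Y a) (∖-closed Y (closed inv)) (∖-same s Y)

      icl′ : InCL ρ1 ρ0 (psub c s′)
      icl′ = subst (InCL ρ1 ρ0) unfold≡ (InCL-unfold-mu icl)

      mu-closed : Closed (mu Y a)
      mu-closed = psub-closed (mu Y c) (closed inv) λ X f → let entry t sX _ _ = entries inv X f in t , sX

      m″≡ : getT M m″ iY ≡ j
      m″≡ = trans (getT-at-same m′ iY) (cong (_∸ 1) m′≡)

      ag′ : Agree< iY m m″
      ag′ i i<iY = trans (ag i i<iY) (sym (getT-at-below m′ iY i i<iY))

      e′Y≡ : e′ Y ≡ approx j
      e′Y≡ = upd-same e Y (approx j)

      entry-Y : Entry c s′ e′ m″ Y
      entry-Y = entry (mu Y a) (↦-same (s ∖ Y) Y (mu Y a))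
        (⊆-trans (⊆-reflexive e′Y≡) (⊆-trans (approx⊆lfp j) (approximation inv)))
        (μ-kind (λ _ _ → idx-< sc) (timed-approx Y c inv icl dfr j m″ m″≡ ag′ ∘ subst (_ ∈ₛ_) e′Y≡))

      entry-other : ∀ {Z} → Z ≢ Y → Entry (mu Y c) s e m Z → Entry c s′ e′ m″ Z
      entry-other {Z} Z≢Y (entry t sZ e⊆t kind) =
        entry t (trans (∖↦-other s (mu Y a) Z≢Y) sZ)
              (⊆-trans (⊆-reflexive (upd-other e (approx j) Z≢Y)) e⊆t) (shift kind)
        where
        shift : ∀ {t} → Kind (mu Y c) e m Z t → Kind c e′ m″ Z t
        shift (ν-kind ¬dfr) = ν-kind ¬dfr
        shift (μ-kind below e⊆t) = μ-kind (λ Y′ d → below Y′ d ∘ omu)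
          (TSem-mu-agree ρ1 ρ0 (λ i i≤iZ → ag′ i (≤-trans i≤iZ (below Y c oref))) ∘ e⊆t
            ∘ subst (_ ∈ₛ_) (upd-other e (approx j) Z≢Y))

      inv′ : Invariant c s′ e′ m″
      inv′ = record
        { subformula = SubAny-trans sc (smu sref)
        ; closed = ↦-closed Y mu-closed (∖-closed Y (closed inv))
        ; entries = λ Z f → case Z ≟ Y of λ
            { (yes refl) → entry-Y
            ; (no Z≢Y) → entry-other Z≢Y (entries inv Z (fmu (Z≢Y ∘ sym) f)) }
        ; fresh = λ Y′ d o → getT-at-above m′ iY (idx ρ1 ρ0 Y′) (idx-pos sc) (idx-< sc o)
                                         (idx≤k (SubAny-trans sc (smu (OccNN⇒SubF o))))
        }

  top : Timeout
  top = replicate (k ρ1 ρ0) n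

  Instance-timed : ∀ {ψ} → Instance ψ → InCL ρ1 ρ0 ψ → sem M ψ ⊆⟦ top ⟧ ψ
  Instance-timed (inst c s refl sc cs bs) icl w∈ = timed c inv icl (subst (_ ∈ₛ_) (psub-sem c s e₀ cs) w∈)
    where
    bound⊆ : ∀ {Z t} → s Z ≡ just t → overlay e₀ s Z ⊆ sem M t
    bound⊆ sZ rewrite sZ = ⊆-refl
    entries₀ : ∀ Z → FreeIn Z c → Entry c s (overlay e₀ s) top Z
    entries₀ Z f with bs Z f
    ... | μ-bound d sZ r icl′ below _ = entry (mu Z d) sZ (bound⊆ sZ) (μ-kind below (Instance-timed r icl′ ∘ bound⊆ sZ))
    ... | ν-bound d sZ r _ = entry (nu Z d) sZ (bound⊆ sZ) (ν-kind (Instance-nu-non-deferral r))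
    inv : Invariant c s (overlay e₀ s) top
    inv = record
      { subformula = sc
      ; closed = cs
      ; entries = entries₀
      ; fresh = λ Y d o → let sY = SubAny-trans sc (OccNN⇒SubF o)
                          in getT-replicate (k ρ1 ρ0) n (idx ρ1 ρ0 Y) (idx-pos sY) (idx≤k sY)
      }

replicate-bounded : ∀ l n → All (_≤ n) (replicate l n)
replicate-bounded zero n = []
replicate-bounded (suc l) n = ≤-refl ∷ replicate-bounded l n

lemma3 : (M : Model) (ρ1 ρ0 : Fm)
         → Closed ρ1 → Closed ρ0
         → Clean ρ1 ρ0 → Irredundant ρ1 ρ0 → Guarded ρ1 ρ0 → AltFree ρ1 ρ0
         → (ψ : Fm) → InCL ρ1 ρ0 ψ
         → Σ[ m ∈ Vec ℕ (k ρ1 ρ0) ]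
             (All (_≤ Model.n M) m
              × (∀ w → lookup (sem M ψ) w ≡ true → TSem M ρ1 ρ0 m ψ w))
lemma3 M ρ1 ρ0 cl1 cl0 clean irr _ alt ψ icl =
  top , replicate-bounded (k ρ1 ρ0) (Model.n M) ,
  λ w w∈ψ → Instance-timed (Instance-closure cl1 cl0 icl) icl (lookup⇒[]= w (sem M ψ) w∈ψ)
  where
  open Soundness M ρ1 ρ0 clean irr alt
  open Instances ρ1 ρ0 clean irr alt using (Instance-closure)
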